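{- Let $T$ be a tree with vertex set $[n]$ and degree sequence $s=(d_v)_{v=1}^n$. Then \[\deg_f(T)=dpe(s)=\binom{n-1}{2}-\sum_{v=1}^{n}\binom{d_v}{2}=\binom{n}{2}-\frac{1}{2}|s|^2,\] where $\binom{i}{j}=0$ if $i<j$ and $|s|^2=\sum_v d_v^2$.
   Context: A 2-switch acting on a graph $G$ is given by distinct vertices $a,b,c,d$ with $ab,cd\in E(G)$, $ac,bd\notin E(G)$, and transforms $G$ into $(G-\{ab,cd\})+\{ac,bd\}$. For a forest $F$, the f-degree $\deg_f(F)$ is the number of distinct graphs obtainable from $F$ by a single 2-switch that are again forests (i.e. the degree of $F$ in the subgraph of the realization graph of its degree sequence induced by forests). $dpe(s)$ is the number of unordered pairs of vertex-disjoint edges of any graph with degree sequence $s$. -}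

module Defs where

open import Data.Nat using (ℕ; zero; suc; _+_; _≤_)
open import Data.Bool using (Bool; true; false; if_then_else_; _∧_; _∨_)
open import Data.Fin using (Fin; _≟_; _<_)
open import Data.Vec using (Vec; lookup; tabulate)
import Data.Vec as V
open import Data.List using (List; []; _∷_; length; _∷ʳ_)
open import Data.List.Relation.Unary.Unique.Propositional using (Unique)
open import Data.List.Relation.Unary.Linked using (Linked)
open import Data.List.Membership.Propositional using (_∈_)
open import Data.Product using (Σ; _×_; _,_)
open import Function.Bundles using (_⇔_)
open import Relation.Nullary using (¬_; does)
open import Relation.Binary.PropositionalEquality using (_≡_; _≢_)

-- A graph on vertex set Fin n (= [n]) is given by its adjacency matrix.
Graph : ℕ → Set
Graph n = Vec (Vec Bool n) n

Adj : ∀ {n} → Graph n → Fin n → Fin n → Set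
Adj G u v = lookup (lookup G u) v ≡ true

SimpleGraph : ∀ {n} → Graph n → Set
SimpleGraph G = (∀ u v → lookup (lookup G u) v ≡ lookup (lookup G v) u)
              × (∀ u → lookup (lookup G u) u ≡ false)

b2n : Bool → ℕ
b2n true = 1
b2n false = 0

deg : ∀ {n} → Graph n → Fin n → ℕ
deg G v = V.sum (V.map b2n (lookup G v))

∑ : ∀ {n} → (Fin n → ℕ) → ℕ
∑ f = V.sum (tabulate f)

data Walk {n} (G : Graph n) : Fin n → Fin n → Set where
  here : ∀ {u} → Walk G u u
  step : ∀ {u w v} → Adj G u w → Walk G w v → Walk G u v

Connected : ∀ {n} → Graph n → Set
Connected G = ∀ u v → Walk G u v

HasCycle : ∀ {n} → Graph n → Set
HasCycle {n} G =
  Σ (Fin n) λ x → Σ (List (Fin n)) λ ys → Σ (Fin n) λ y →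
    1 ≤ length ys × Unique ((x ∷ ys) ∷ʳ y) × Linked (Adj G) ((x ∷ ys) ∷ʳ y) × Adj G y x

IsForest : ∀ {n} → Graph n → Set
IsForest G = SimpleGraph G × ¬ HasCycle G

IsTree : ∀ {n} → Graph n → Set
IsTree G = SimpleGraph G × Connected G × ¬ HasCycle G

samePair : ∀ {n} → Fin n → Fin n → Fin n → Fin n → Bool
samePair u v a b = (does (u ≟ a) ∧ does (v ≟ b)) ∨ (does (u ≟ b) ∧ does (v ≟ a))

switch : ∀ {n} → Graph n → Fin n → Fin n → Fin n → Fin n → Graph n
switch G a b c d = tabulate λ u → tabulate λ v →
  if samePair u v a b ∨ samePair u v c d then false
  else if samePair u v a c ∨ samePair u v b d then true
  else lookup (lookup G u) v

TwoSwitch : ∀ {n} → Graph n → Graph n → Set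
TwoSwitch {n} G H = Σ (Fin n) λ a → Σ (Fin n) λ b → Σ (Fin n) λ c → Σ (Fin n) λ d →
  (a ≢ b × a ≢ c × a ≢ d × b ≢ c × b ≢ d × c ≢ d)
  × Adj G a b × Adj G c d × ¬ Adj G a c × ¬ Adj G b d
  × H ≡ switch G a b c d

HasSize : ∀ {A : Set} → (A → Set) → ℕ → Set
HasSize {A} P k = Σ (List A) λ L → Unique L × (∀ x → (x ∈ L) ⇔ P x) × length L ≡ k

-- forests obtainable from G by one 2-switch (deg_f G is the size of this set)
FNeighbour : ∀ {n} → Graph n → Graph n → Set
FNeighbour G H = IsForest H × TwoSwitch G H

-- unordered pairs {ab, cd} of vertex-disjoint edges, represented canonically
-- by the tuple (a,b,c,d) with a < b, c < d, a < c
DisjointEdgePair : ∀ {n} → Graph n → (Fin n × Fin n × Fin n × Fin n) → Set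
DisjointEdgePair G (a , b , c , d) =
  a < b × c < d × a < c × b ≢ c × b ≢ d × Adj G a b × Adj G c d

-- Let ab, cd be disjoint edges of a tree T. The path of T joining the two edges meets them in one
-- endpoint each, say b and c, so T − {ab, cd} has three components, containing a, {b, c} and d.
-- The 2-switch adding ac and bd joins them into a tree again, while the one adding ad and bc closes a
-- cycle through the path from b to c. Hence the forest neighbours of T correspond to the unordered
-- pairs of disjoint edges. Counting quadruples (a, b, c, d) with ab, cd edges by inclusion–exclusion
-- over the coincidences a = c, a = d, b = c, b = d gives 8 dpe + 4 ∑ d_v² = S² + 2S for every simple
-- graph with degree sum S, so dpe depends only on the degree sequence; for a tree S = 2(n − 1),
-- since every vertex but the root has exactly one parent.

module Submission where

open import Defs
open import Level using (0ℓ)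
open import Data.Nat using (ℕ; zero; suc; _+_; _*_; _∸_; _^_; _≤_; z≤n; s≤s)
import Data.Nat as ℕ
open import Data.Nat.Properties
  using (+-0-commutativeMonoid; +-*-semiring; +-identityʳ; +-assoc; +-cancelʳ-≡; *-comm; *-assoc; *-identityʳ;
         *-distribˡ-+; *-cancelˡ-≡; ≤-trans; ≤-refl; ≤-reflexive; n≤1+n; ≤-antisym; ≤-<-trans; suc-injective; 1+n≢n)
import Data.Nat.Properties as ℕₚ
open import Data.Nat.Combinatorics using (_C_; nC1≡n; nCk+nC[k+1]≡[n+1]C[k+1])
open import Data.Nat.Tactic.RingSolver using (solve-∀)
open import Data.Bool using (Bool; true; false; if_then_else_)
import Data.Bool.Properties as Bool
open import Data.Fin using (Fin; zero; suc; _≟_; _<_)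
open import Data.Fin.Properties using (_<?_; <-cmp; <-irrefl; <-asym; <-trans; <⇒≢; any?)
open import Data.Vec using (Vec; []; _∷_; lookup; tabulate)
import Data.Vec as Vec
open import Data.Vec.Properties using (lookup∘tabulate; tabulate-cong)
open import Data.List using (List; []; _∷_; _∷ʳ_; _++_; length; map; filter; cartesianProduct; allFin)
import Data.List as List
open import Data.List.Properties using (filter-++; length-++; length-map)
open import Data.List.Relation.Unary.All using (All; []; _∷_)
open import Data.List.Relation.Unary.All.Properties using (∷ʳ⁻)
open import Data.List.Relation.Unary.Any using (here; there)
open import Data.List.Relation.Unary.AllPairs using ([]; _∷_)
open import Data.List.Relation.Unary.Linked using (Linked; []; [-]; _∷_)
import Data.List.Relation.Unary.Linked as Linked
open import Data.List.Relation.Unary.Unique.Propositional using (Unique)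
open import Data.List.Relation.Unary.Unique.Propositional.Properties using (filter⁺; cartesianProduct⁺; allFin⁺)
open import Data.List.Membership.Propositional using (_∈_; _∉_)
open import Data.List.Membership.Propositional.Properties using (∈-filter⁺; ∈-filter⁻; ∈-cartesianProduct⁺; ∈-allFin; ∈-map⁺; ∈-map⁻)
open import Data.Product using (Σ; ∃; _×_; _,_; proj₁; proj₂)
import Data.Product as Product
open import Data.Sum using (_⊎_; inj₁; inj₂; [_,_]′)
import Data.Sum as Sum
open import Data.Empty using (⊥; ⊥-elim)
open import Function using (id; _∘_; _⇔_; mk⇔; Equivalence)
open import Relation.Binary using (Rel; Symmetric; tri<; tri≈; tri>)
open import Relation.Binary.Construct.Closure.ReflexiveTransitive using (Star; ε; _◅_; _◅◅_)
import Relation.Binary.Construct.Closure.ReflexiveTransitive as Star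
open import Relation.Nullary using (Dec; yes; no; does; ¬_)
open import Relation.Nullary.Decidable using (_×-dec_; _⊎-dec_; ¬?; dec-true; dec-false; does-⇔)
open import Relation.Unary using (Decidable)
open import Relation.Binary.PropositionalEquality using (_≡_; _≢_; _≗_; ≢-sym; refl; sym; trans; cong; cong₂; subst)
open import Algebra.Properties.CommutativeMonoid.Sum +-0-commutativeMonoid using (sum; sum-cong-≗; sum-replicate-zero)
import Algebra.Properties.CommutativeMonoid.Sum +-0-commutativeMonoid as MonoidSum
open import Algebra.Properties.Semiring.Sum +-*-semiring using (*-distribˡ-sum)
open Relation.Binary.PropositionalEquality.≡-Reasoning

⟦_⟧ : ∀ {P : Set} → Dec P → ℕ
⟦ p? ⟧ = b2n (does p?)

⟦⟧-cong : ∀ {P Q : Set} → P ⇔ Q → (p? : Dec P) (q? : Dec Q) → ⟦ p? ⟧ ≡ ⟦ q? ⟧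
⟦⟧-cong P⇔Q p? q? = cong b2n (does-⇔ P⇔Q p? q?)

⟦⟧-no : ∀ {P : Set} → ¬ P → (p? : Dec P) → ⟦ p? ⟧ ≡ 0
⟦⟧-no ¬p p? = cong b2n (dec-false p? ¬p)

⟦⟧-idem : ∀ {P : Set} (p? : Dec P) → ⟦ p? ⟧ * ⟦ p? ⟧ ≡ ⟦ p? ⟧
⟦⟧-idem (yes _) = refl
⟦⟧-idem (no _)  = refl

⟦×-dec⟧ : ∀ {P Q : Set} (p? : Dec P) (q? : Dec Q) → ⟦ p? ×-dec q? ⟧ ≡ ⟦ p? ⟧ * ⟦ q? ⟧
⟦×-dec⟧ (yes _) q? = sym (+-identityʳ ⟦ q? ⟧)
⟦×-dec⟧ (no _)  q? = refl

⟦⊎-dec⟧ : ∀ {P Q : Set} → ¬ (P × Q) → (p? : Dec P) (q? : Dec Q) → ⟦ p? ⊎-dec q? ⟧ ≡ ⟦ p? ⟧ + ⟦ q? ⟧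
⟦⊎-dec⟧ ¬both (yes p) (yes q) = ⊥-elim (¬both (p , q))
⟦⊎-dec⟧ ¬both (yes _) (no _)  = refl
⟦⊎-dec⟧ ¬both (no _)  q?      = refl

∑≡sum : ∀ {n} (f : Fin n → ℕ) → ∑ f ≡ sum f
∑≡sum {zero} f = refl
∑≡sum {suc n} f = cong (f zero +_) (∑≡sum (f ∘ suc))

∑-cong : ∀ {n} {f g : Fin n → ℕ} → f ≗ g → ∑ f ≡ ∑ g
∑-cong {f = f} {g} f≗g = trans (∑≡sum f) (trans (sum-cong-≗ f≗g) (sym (∑≡sum g)))

∑-zero : ∀ n → ∑ {n} (λ _ → 0) ≡ 0
∑-zero n = trans (∑≡sum {n} (λ _ → 0)) (sum-replicate-zero n)

∑-distrib-+ : ∀ {n} (f g : Fin n → ℕ) → ∑ (λ i → f i + g i) ≡ ∑ f + ∑ g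
∑-distrib-+ f g = begin
  ∑ (λ i → f i + g i)   ≡⟨ ∑≡sum (λ i → f i + g i) ⟩
  sum (λ i → f i + g i) ≡⟨ MonoidSum.∑-distrib-+ f g ⟩
  sum f + sum g         ≡⟨ sym (cong₂ _+_ (∑≡sum f) (∑≡sum g)) ⟩
  ∑ f + ∑ g             ∎

∑-comm : ∀ {m n} (f : Fin m → Fin n → ℕ) → ∑ (λ i → ∑ (f i)) ≡ ∑ (λ j → ∑ (λ i → f i j))
∑-comm f = begin
  ∑ (λ i → ∑ (f i))                 ≡⟨ ∑-cong (∑≡sum ∘ f) ⟩
  ∑ (λ i → sum (f i))               ≡⟨ ∑≡sum (λ i → sum (f i)) ⟩
  sum (λ i → sum (f i))             ≡⟨ MonoidSum.∑-comm f ⟩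
  sum (λ j → sum (λ i → f i j))     ≡⟨ sym (∑≡sum (λ j → sum (λ i → f i j))) ⟩
  ∑ (λ j → sum (λ i → f i j))       ≡⟨ sym (∑-cong (λ j → ∑≡sum (λ i → f i j))) ⟩
  ∑ (λ j → ∑ (λ i → f i j))         ∎

∑-*ˡ : ∀ {n} k (f : Fin n → ℕ) → ∑ (λ i → k * f i) ≡ k * ∑ f
∑-*ˡ k f = begin
  ∑ (λ i → k * f i)   ≡⟨ ∑≡sum (λ i → k * f i) ⟩
  sum (λ i → k * f i) ≡⟨ sym (*-distribˡ-sum k f) ⟩
  k * sum f           ≡⟨ cong (k *_) (sym (∑≡sum f)) ⟩
  k * ∑ f             ∎

∑-*ʳ : ∀ {n} k (f : Fin n → ℕ) → ∑ (λ i → f i * k) ≡ ∑ f * k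
∑-*ʳ k f = trans (∑-cong (λ i → *-comm (f i) k)) (trans (∑-*ˡ k f) (*-comm k (∑ f)))

∑-δ : ∀ {n} (a : Fin n) (h : Fin n → ℕ) → ∑ (λ c → ⟦ a ≟ c ⟧ * h c) ≡ h a
∑-δ {suc n} zero h = trans (cong₂ _+_ (+-identityʳ (h zero)) (∑-zero n)) (+-identityʳ (h zero))
∑-δ {suc n} (suc a) h = ∑-δ a (h ∘ suc)

⟦<⟧+⟦>⟧ : ∀ {n} {x y : Fin n} → x ≢ y → ⟦ x <? y ⟧ + ⟦ y <? x ⟧ ≡ 1
⟦<⟧+⟦>⟧ {x = x} {y} x≢y with <-cmp x y
... | tri< x<y _ y≮x = cong₂ _+_ (cong b2n (dec-true (x <? y) x<y)) (cong b2n (dec-false (y <? x) y≮x))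
... | tri≈ _ x≡y _   = ⊥-elim (x≢y x≡y)
... | tri> x≮y _ y<x = cong₂ _+_ (cong b2n (dec-false (x <? y) x≮y)) (cong b2n (dec-true (y <? x) y<x))

∑²-halve : ∀ {n} (g : Fin n → Fin n → ℕ) → (∀ x y → g y x ≡ g x y) → (∀ x → g x x ≡ 0) →
           ∑ (λ x → ∑ (g x)) ≡ 2 * ∑ (λ x → ∑ (λ y → g x y * ⟦ x <? y ⟧))
∑²-halve g sym-g diag-g = begin
  ∑ (λ x → ∑ (g x))                              ≡⟨ ∑-cong (λ x → ∑-cong (split x)) ⟩
  ∑ (λ x → ∑ (λ y → below x y + below y x))     ≡⟨ ∑-cong (λ x → ∑-distrib-+ (below x) (λ y → below y x)) ⟩
  ∑ (λ x → ∑ (below x) + ∑ (λ y → below y x))  ≡⟨ ∑-distrib-+ (λ x → ∑ (below x)) _ ⟩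
  B + ∑ (λ x → ∑ (λ y → below y x))            ≡⟨ cong (B +_) (sym (∑-comm below)) ⟩
  B + B                                          ≡⟨ cong (B +_) (sym (+-identityʳ B)) ⟩
  2 * B                                          ∎
  where
    below : Fin _ → Fin _ → ℕ
    below x y = g x y * ⟦ x <? y ⟧
    B : ℕ
    B = ∑ (λ x → ∑ (below x))
    split : ∀ x y → g x y ≡ below x y + below y x
    split x y with x ≟ y
    ... | yes refl rewrite diag-g x = refl
    ... | no x≢y = begin
      g x y                                   ≡⟨ sym (*-identityʳ (g x y)) ⟩
      g x y * 1                               ≡⟨ cong (g x y *_) (sym (⟦<⟧+⟦>⟧ x≢y)) ⟩
      g x y * (⟦ x <? y ⟧ + ⟦ y <? x ⟧)       ≡⟨ *-distribˡ-+ (g x y) _ _ ⟩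
      below x y + g x y * ⟦ y <? x ⟧          ≡⟨ cong (λ z → below x y + z * ⟦ y <? x ⟧) (sym (sym-g x y)) ⟩
      below x y + below y x                   ∎

∑-ones : ∀ m → ∑ {m} (λ _ → 1) ≡ m
∑-ones zero    = refl
∑-ones (suc m) = cong suc (∑-ones m)

module _ {n : ℕ} where

  ∑⁴ : (Fin n → Fin n → Fin n → Fin n → ℕ) → ℕ
  ∑⁴ g = ∑ λ a → ∑ λ b → ∑ λ c → ∑ λ d → g a b c d

  ∑⁴-cong : ∀ {f g : Fin n → Fin n → Fin n → Fin n → ℕ} → (∀ a b c d → f a b c d ≡ g a b c d) → ∑⁴ f ≡ ∑⁴ g
  ∑⁴-cong f≡g = ∑-cong λ a → ∑-cong λ b → ∑-cong λ c → ∑-cong λ d → f≡g a b c d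

  ∑⁴-distrib-+ : ∀ (f g : Fin n → Fin n → Fin n → Fin n → ℕ) →
                 ∑⁴ (λ a b c d → f a b c d + g a b c d) ≡ ∑⁴ f + ∑⁴ g
  ∑⁴-distrib-+ f g =
    trans (∑-cong λ a → trans (∑-cong λ b → trans (∑-cong λ c → ∑-distrib-+ (f a b c) (g a b c))
                                                  (∑-distrib-+ (λ c → ∑ (f a b c)) (λ c → ∑ (g a b c))))
                              (∑-distrib-+ (λ b → ∑ λ c → ∑ (f a b c)) (λ b → ∑ λ c → ∑ (g a b c))))
          (∑-distrib-+ (λ a → ∑ λ b → ∑ λ c → ∑ (f a b c)) (λ a → ∑ λ b → ∑ λ c → ∑ (g a b c)))

  ∑⁴-relabel₁₂ : ∀ {f g : Fin n → Fin n → Fin n → Fin n → ℕ} → (∀ a b c d → f a b c d ≡ g b a c d) → ∑⁴ f ≡ ∑⁴ g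
  ∑⁴-relabel₁₂ {f} {g} f≡g = trans (∑⁴-cong f≡g) (∑-comm (λ a b → ∑ λ c → ∑ λ d → g b a c d))

  ∑⁴-relabel₃₄ : ∀ {f g : Fin n → Fin n → Fin n → Fin n → ℕ} → (∀ a b c d → f a b c d ≡ g a b d c) → ∑⁴ f ≡ ∑⁴ g
  ∑⁴-relabel₃₄ {f} {g} f≡g = trans (∑⁴-cong f≡g) (∑-cong λ a → ∑-cong λ b → ∑-comm (λ c d → g a b d c))

  ∑⁴-swap₂₃ : ∀ (g : Fin n → Fin n → Fin n → Fin n → ℕ) →
              ∑⁴ g ≡ ∑ λ a → ∑ λ c → ∑ λ b → ∑ λ d → g a b c d
  ∑⁴-swap₂₃ g = ∑-cong λ a → ∑-comm (λ b c → ∑ (g a b c))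

  ∑²-*ˡ : ∀ k (f : Fin n → Fin n → ℕ) → ∑ (λ x → ∑ (λ y → k * f x y)) ≡ k * ∑ (λ x → ∑ (f x))
  ∑²-*ˡ k f = trans (∑-cong (λ x → ∑-*ˡ k (f x))) (∑-*ˡ k (λ x → ∑ (f x)))

  ∑²-*ʳ : ∀ k (f : Fin n → Fin n → ℕ) → ∑ (λ x → ∑ (λ y → f x y * k)) ≡ ∑ (λ x → ∑ (f x)) * k
  ∑²-*ʳ k f = trans (∑-cong (λ x → ∑-*ʳ k (f x))) (∑-*ʳ k (λ x → ∑ (f x)))

  ∑²-δ : ∀ a b (h : Fin n → Fin n → ℕ) → ∑ (λ c → ∑ (λ d → ⟦ a ≟ c ⟧ * (⟦ b ≟ d ⟧ * h c d))) ≡ h a b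
  ∑²-δ a b h = trans (∑-cong (λ c → ∑-*ˡ ⟦ a ≟ c ⟧ (λ d → ⟦ b ≟ d ⟧ * h c d)))
                     (trans (∑-δ a (λ c → ∑ (λ d → ⟦ b ≟ d ⟧ * h c d))) (∑-δ b (h a)))

module _ {A : Set} where

  SameEdge : A → A → A → A → Set
  SameEdge u v x y = (u ≡ x × v ≡ y) ⊎ (u ≡ y × v ≡ x)

  SameEdge-refl : ∀ {x y} → SameEdge x y x y
  SameEdge-refl = inj₁ (refl , refl)

  SameEdge-flip : ∀ {x y} → SameEdge x y y x
  SameEdge-flip = inj₂ (refl , refl)

  SameEdge-swapˡ : ∀ {u v x y} → SameEdge u v x y → SameEdge v u x y
  SameEdge-swapˡ (inj₁ (p , q)) = inj₂ (q , p)
  SameEdge-swapˡ (inj₂ (p , q)) = inj₁ (q , p)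

  SameEdge-swapʳ : ∀ {u v x y} → SameEdge u v x y → SameEdge u v y x
  SameEdge-swapʳ (inj₁ e) = inj₂ e
  SameEdge-swapʳ (inj₂ e) = inj₁ e

  SameEdge-sym : ∀ {u v x y} → SameEdge u v x y → SameEdge x y u v
  SameEdge-sym (inj₁ (refl , refl)) = SameEdge-refl
  SameEdge-sym (inj₂ (refl , refl)) = SameEdge-flip

  SameEdge-trans : ∀ {u v x y p q} → SameEdge u v x y → SameEdge x y p q → SameEdge u v p q
  SameEdge-trans (inj₁ (refl , refl)) e = e
  SameEdge-trans (inj₂ (refl , refl)) e = SameEdge-swapˡ e

sameEdge? : ∀ {n} (u v x y : Fin n) → Dec (SameEdge u v x y)
sameEdge? u v x y = (u ≟ x ×-dec v ≟ y) ⊎-dec (u ≟ y ×-dec v ≟ x)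

module SimpleGraphProperties {n : ℕ} (G : Graph n) (simple : SimpleGraph G) where

  Adj-sym : ∀ {u v} → Adj G u v → Adj G v u
  Adj-sym {u} {v} uv = trans (sym (proj₁ simple u v)) uv

  Adj-irrefl : ∀ {u} → ¬ Adj G u u
  Adj-irrefl {u} uu with trans (sym uu) (proj₂ simple u)
  ... | ()

  Adj⇒≢ : ∀ {u v} → Adj G u v → u ≢ v
  Adj⇒≢ uv refl = Adj-irrefl uv

  Adj-SameEdge : ∀ {u v x y} → Adj G x y → SameEdge u v x y → Adj G u v
  Adj-SameEdge xy (inj₁ (refl , refl)) = xy
  Adj-SameEdge xy (inj₂ (refl , refl)) = Adj-sym xy

sum-map-b2n : ∀ {m} (r : Vec Bool m) → Vec.sum (Vec.map b2n r) ≡ ∑ (λ v → ⟦ lookup r v Bool.≟ true ⟧)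
sum-map-b2n []          = refl
sum-map-b2n (true ∷ r)  = cong suc (sum-map-b2n r)
sum-map-b2n (false ∷ r) = sum-map-b2n r

module _ {n : ℕ} (G : Graph n) where

  adj? : ∀ u v → Dec (Adj G u v)
  adj? u v = lookup (lookup G u) v Bool.≟ true

  deg≡∑⟦adj⟧ : ∀ u → deg G u ≡ ∑ (λ v → ⟦ adj? u v ⟧)
  deg≡∑⟦adj⟧ u = sum-map-b2n (lookup G u)

-- Counting pairs of disjoint edges

module _ {A : Set} {P : A → Set} (P? : Decidable P) where

  length-filter-map : ∀ {B : Set} (g : B → A) (ys : List B) → length (filter P? (map g ys)) ≡ length (filter (P? ∘ g) ys)
  length-filter-map g [] = refl
  length-filter-map g (y ∷ ys) with does (P? (g y))
  ... | true  = cong suc (length-filter-map g ys)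
  ... | false = length-filter-map g ys

  length-filter-tabulate : ∀ {m} (f : Fin m → A) → length (filter P? (List.tabulate f)) ≡ ∑ (λ i → ⟦ P? (f i) ⟧)
  length-filter-tabulate {zero} f = refl
  length-filter-tabulate {suc m} f with does (P? (f zero))
  ... | true  = cong suc (length-filter-tabulate (f ∘ suc))
  ... | false = length-filter-tabulate (f ∘ suc)

length-filter-cartesianProduct : ∀ {B C : Set} {P : B × C → Set} (P? : Decidable P) {m} (f : Fin m → B) (ys : List C) →
  length (filter P? (cartesianProduct (List.tabulate f) ys)) ≡ ∑ (λ i → length (filter (λ y → P? (f i , y)) ys))
length-filter-cartesianProduct P? {zero} f ys = refl
length-filter-cartesianProduct P? {suc m} f ys = begin
  length (filter P? (map (f zero ,_) ys ++ rest))            ≡⟨ cong length (filter-++ P? (map (f zero ,_) ys) rest) ⟩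
  length (filter P? (map (f zero ,_) ys) ++ filter P? rest)  ≡⟨ length-++ (filter P? (map (f zero ,_) ys)) ⟩
  length (filter P? (map (f zero ,_) ys)) + length (filter P? rest)
    ≡⟨ cong₂ _+_ (length-filter-map P? (f zero ,_) ys) (length-filter-cartesianProduct P? (f ∘ suc) ys) ⟩
  ∑ (λ i → length (filter (λ y → P? (f i , y)) ys))         ∎
  where
    rest = cartesianProduct (List.tabulate (f ∘ suc)) ys

Tuple : ℕ → Set
Tuple n = Fin n × Fin n × Fin n × Fin n

tuples : ∀ n → List (Tuple n)
tuples n = cartesianProduct (allFin n) (cartesianProduct (allFin n) (cartesianProduct (allFin n) (allFin n)))

tuples-unique : ∀ n → Unique (tuples n)
tuples-unique n = cartesianProduct⁺ (allFin⁺ n) (cartesianProduct⁺ (allFin⁺ n) (cartesianProduct⁺ (allFin⁺ n) (allFin⁺ n)))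

∈-tuples : ∀ {n} (p : Tuple n) → p ∈ tuples n
∈-tuples (a , b , c , d) =
  ∈-cartesianProduct⁺ (∈-allFin a) (∈-cartesianProduct⁺ (∈-allFin b) (∈-cartesianProduct⁺ (∈-allFin c) (∈-allFin d)))

length-filter-tuples : ∀ {n} {P : Tuple n → Set} (P? : Decidable P) →
  length (filter P? (tuples n)) ≡ ∑⁴ (λ a b c d → ⟦ P? (a , b , c , d) ⟧)
length-filter-tuples P? =
  trans (length-filter-cartesianProduct P? id _) (∑-cong λ a →
  trans (length-filter-cartesianProduct (λ y → P? (a , y)) id _) (∑-cong λ b →
  trans (length-filter-cartesianProduct (λ y → P? (a , b , y)) id _) (∑-cong λ c →
  length-filter-tabulate (λ y → P? (a , b , c , y)) id)))

module _ {n : ℕ} (G : Graph n) where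

  disjointEdgePair? : Decidable (DisjointEdgePair G)
  disjointEdgePair? (a , b , c , d) =
    a <? b ×-dec c <? d ×-dec a <? c ×-dec ¬? (b ≟ c) ×-dec ¬? (b ≟ d) ×-dec adj? G a b ×-dec adj? G c d

  disjointEdgePairs : List (Tuple n)
  disjointEdgePairs = filter disjointEdgePair? (tuples n)

  disjointEdgePairs-size : HasSize (DisjointEdgePair G) (length disjointEdgePairs)
  disjointEdgePairs-size =
    disjointEdgePairs , filter⁺ disjointEdgePair? (tuples-unique n) ,
    (λ p → mk⇔ (proj₂ ∘ ∈-filter⁻ disjointEdgePair? {xs = tuples n}) (∈-filter⁺ disjointEdgePair? (∈-tuples p))) , refl

module DisjointEdgePairCount {n : ℕ} (G : Graph n) (simple : SimpleGraph G) where

  open SimpleGraphProperties G simple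

  ⟦edge⟧ : Fin n → Fin n → ℕ
  ⟦edge⟧ u v = ⟦ adj? G u v ⟧

  ⟦edge⟧-sym : ∀ u v → ⟦edge⟧ v u ≡ ⟦edge⟧ u v
  ⟦edge⟧-sym u v = ⟦⟧-cong (mk⇔ Adj-sym Adj-sym) (adj? G v u) (adj? G u v)

  δ : Fin n → Fin n → ℕ
  δ u v = ⟦ u ≟ v ⟧

  deg≡∑⟦edge⟧ : ∀ u → deg G u ≡ ∑ (⟦edge⟧ u)
  deg≡∑⟦edge⟧ = deg≡∑⟦adj⟧ G

  S Q : ℕ
  S = ∑ (deg G)
  Q = ∑ λ u → deg G u * deg G u

  S≡∑²⟦edge⟧ : S ≡ ∑ λ a → ∑ (⟦edge⟧ a)
  S≡∑²⟦edge⟧ = ∑-cong deg≡∑⟦edge⟧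

  ⟦edges⟧ : Fin n → Fin n → Fin n → Fin n → ℕ
  ⟦edges⟧ a b c d = ⟦edge⟧ a b * ⟦edge⟧ c d

  Disjoint : Fin n → Fin n → Fin n → Fin n → Set
  Disjoint a b c d = Adj G a b × Adj G c d × a ≢ c × a ≢ d × b ≢ c × b ≢ d

  disjoint? : ∀ a b c d → Dec (Disjoint a b c d)
  disjoint? a b c d =
    adj? G a b ×-dec adj? G c d ×-dec ¬? (a ≟ c) ×-dec ¬? (a ≟ d) ×-dec ¬? (b ≟ c) ×-dec ¬? (b ≟ d)

  ⟦disjoint⟧ : Fin n → Fin n → Fin n → Fin n → ℕ
  ⟦disjoint⟧ a b c d = ⟦ disjoint? a b c d ⟧

  -- ⟦edges⟧ restricted to coincidences of the indicated positions of (a, b, c, d)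
  E₁₃₂₄ E₁₄₂₃ E₁₃ E₁₄ E₂₃ E₂₄ : Fin n → Fin n → Fin n → Fin n → ℕ
  E₁₃₂₄ a b c d = ⟦edges⟧ a b c d * (δ a c * δ b d)
  E₁₄₂₃ a b c d = ⟦edges⟧ a b c d * (δ a d * δ b c)
  E₁₃ a b c d = ⟦edges⟧ a b c d * δ a c
  E₁₄ a b c d = ⟦edges⟧ a b c d * δ a d
  E₂₃ a b c d = ⟦edges⟧ a b c d * δ b c
  E₂₄ a b c d = ⟦edges⟧ a b c d * δ b d

  -- Edges ab, cd of a simple graph satisfy at most two of a = c, a = d, b = c, b = d,
  -- and two only as {a = c, b = d} or {a = d, b = c}.
  inclusion-exclusion : ∀ a b c d →
    ⟦edges⟧ a b c d + (E₁₃₂₄ a b c d + E₁₄₂₃ a b c d) ≡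
    ⟦disjoint⟧ a b c d + (E₁₃ a b c d + (E₁₄ a b c d + (E₂₃ a b c d + E₂₄ a b c d)))
  inclusion-exclusion a b c d with adj? G a b | adj? G c d
  ... | no _  | _     = refl
  ... | yes _ | no _  = refl
  ... | yes ab | yes cd with a ≟ c | a ≟ d | b ≟ c | b ≟ d
  ...   | no _     | no _     | no _     | no _     = refl
  ...   | yes _    | no _     | no _     | no _     = refl
  ...   | no _     | yes _    | no _     | no _     = refl
  ...   | no _     | no _     | yes _    | no _     = refl
  ...   | no _     | no _     | no _     | yes _    = refl
  ...   | yes _    | no _     | no _     | yes _    = refl
  ...   | no _     | yes _    | yes _    | no _     = refl
  ...   | yes refl | yes refl | _        | _        = ⊥-elim (Adj-irrefl cd)
  ...   | yes refl | _        | yes refl | _        = ⊥-elim (Adj-irrefl ab)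
  ...   | _        | yes refl | _        | yes refl = ⊥-elim (Adj-irrefl ab)
  ...   | _        | _        | yes refl | yes refl = ⊥-elim (Adj-irrefl cd)

  ∑⁴⟦edges⟧ : ∑⁴ ⟦edges⟧ ≡ S * S
  ∑⁴⟦edges⟧ = begin
    ∑⁴ ⟦edges⟧
      ≡⟨ ∑-cong (λ a → ∑-cong λ b → ∑²-*ˡ (⟦edge⟧ a b) ⟦edge⟧) ⟩
    (∑ λ a → ∑ λ b → ⟦edge⟧ a b * ∑ (λ c → ∑ (⟦edge⟧ c)))
      ≡⟨ ∑²-*ʳ _ ⟦edge⟧ ⟩
    (∑ λ a → ∑ (⟦edge⟧ a)) * ∑ (λ c → ∑ (⟦edge⟧ c))
      ≡⟨ sym (cong₂ _*_ S≡∑²⟦edge⟧ S≡∑²⟦edge⟧) ⟩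
    S * S
      ∎

  ∑⁴E₁₃₂₄ : ∑⁴ E₁₃₂₄ ≡ S
  ∑⁴E₁₃₂₄ = begin
    ∑⁴ E₁₃₂₄
      ≡⟨ ∑⁴-cong (λ a b c d → reorder (⟦edges⟧ a b c d) (δ a c) (δ b d)) ⟩
    ∑⁴ (λ a b c d → δ a c * (δ b d * ⟦edges⟧ a b c d))
      ≡⟨ ∑-cong (λ a → ∑-cong λ b → ∑²-δ a b (⟦edges⟧ a b)) ⟩
    (∑ λ a → ∑ λ b → ⟦edge⟧ a b * ⟦edge⟧ a b)
      ≡⟨ ∑-cong (λ a → ∑-cong λ b → ⟦⟧-idem (adj? G a b)) ⟩
    (∑ λ a → ∑ (⟦edge⟧ a))
      ≡⟨ sym S≡∑²⟦edge⟧ ⟩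
    S
      ∎
    where
      reorder : ∀ x y z → x * (y * z) ≡ y * (z * x)
      reorder = solve-∀

  ∑⁴E₁₃ : ∑⁴ E₁₃ ≡ Q
  ∑⁴E₁₃ = begin
    ∑⁴ E₁₃                                    ≡⟨ ∑⁴-cong (λ a b c d → *-comm (⟦edges⟧ a b c d) (δ a c)) ⟩
    ∑⁴ (λ a b c d → δ a c * ⟦edges⟧ a b c d)  ≡⟨ ∑-cong (λ a → ∑-cong λ b → pick a b) ⟩
    (∑ λ a → ∑ λ b → ⟦edge⟧ a b * deg G a)    ≡⟨ ∑-cong (λ a → ∑-*ʳ (deg G a) (⟦edge⟧ a)) ⟩
    (∑ λ a → ∑ (⟦edge⟧ a) * deg G a)          ≡⟨ sym (∑-cong (λ a → cong (_* deg G a) (deg≡∑⟦edge⟧ a))) ⟩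
    Q                                         ∎
    where
      pick : ∀ a b → ∑ (λ c → ∑ (λ d → δ a c * ⟦edges⟧ a b c d)) ≡ ⟦edge⟧ a b * deg G a
      pick a b = begin
        ∑ (λ c → ∑ (λ d → δ a c * ⟦edges⟧ a b c d))  ≡⟨ ∑-cong (λ c → ∑-*ˡ (δ a c) (⟦edges⟧ a b c)) ⟩
        ∑ (λ c → δ a c * ∑ (⟦edges⟧ a b c))          ≡⟨ ∑-δ a (λ c → ∑ (⟦edges⟧ a b c)) ⟩
        ∑ (⟦edges⟧ a b a)                            ≡⟨ ∑-*ˡ (⟦edge⟧ a b) (⟦edge⟧ a) ⟩
        ⟦edge⟧ a b * ∑ (⟦edge⟧ a)                    ≡⟨ cong (⟦edge⟧ a b *_) (sym (deg≡∑⟦edge⟧ a)) ⟩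
        ⟦edge⟧ a b * deg G a                         ∎

  ⟦edges⟧-swap₁₂ : ∀ a b c d → ⟦edges⟧ b a c d ≡ ⟦edges⟧ a b c d
  ⟦edges⟧-swap₁₂ a b c d = cong (_* ⟦edge⟧ c d) (⟦edge⟧-sym a b)

  ⟦edges⟧-swap₃₄ : ∀ a b c d → ⟦edges⟧ a b d c ≡ ⟦edges⟧ a b c d
  ⟦edges⟧-swap₃₄ a b c d = cong (⟦edge⟧ a b *_) (⟦edge⟧-sym c d)

  degree-identity : S * S + (S + S) ≡ ∑⁴ ⟦disjoint⟧ + (Q + (Q + (Q + Q)))
  degree-identity = begin
    S * S + (S + S)
      ≡⟨ sym (cong₂ _+_ ∑⁴⟦edges⟧ (cong₂ _+_ ∑⁴E₁₃₂₄ (trans ∑⁴E₁₄₂₃≡∑⁴E₁₃₂₄ ∑⁴E₁₃₂₄))) ⟩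
    ∑⁴ ⟦edges⟧ + (∑⁴ E₁₃₂₄ + ∑⁴ E₁₄₂₃)
      ≡⟨ sym (trans (∑⁴-distrib-+ ⟦edges⟧ _) (cong (∑⁴ ⟦edges⟧ +_) (∑⁴-distrib-+ E₁₃₂₄ E₁₄₂₃))) ⟩
    ∑⁴ (λ a b c d → ⟦edges⟧ a b c d + (E₁₃₂₄ a b c d + E₁₄₂₃ a b c d))
      ≡⟨ ∑⁴-cong inclusion-exclusion ⟩
    ∑⁴ (λ a b c d → ⟦disjoint⟧ a b c d + (E₁₃ a b c d + (E₁₄ a b c d + (E₂₃ a b c d + E₂₄ a b c d))))
      ≡⟨ ∑⁴-distrib-+ ⟦disjoint⟧ _ ⟩
    ∑⁴ ⟦disjoint⟧ + ∑⁴ (λ a b c d → E₁₃ a b c d + (E₁₄ a b c d + (E₂₃ a b c d + E₂₄ a b c d)))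
      ≡⟨ cong (∑⁴ ⟦disjoint⟧ +_) four-Q ⟩
    ∑⁴ ⟦disjoint⟧ + (Q + (Q + (Q + Q)))
      ∎
    where
      ∑⁴E₁₄₂₃≡∑⁴E₁₃₂₄ : ∑⁴ E₁₄₂₃ ≡ ∑⁴ E₁₃₂₄
      ∑⁴E₁₄₂₃≡∑⁴E₁₃₂₄ = ∑⁴-relabel₃₄ (λ a b c d → cong (_* (δ a d * δ b c)) (sym (⟦edges⟧-swap₃₄ a b c d)))
      ∑⁴E₁₄≡∑⁴E₁₃ : ∑⁴ E₁₄ ≡ ∑⁴ E₁₃
      ∑⁴E₁₄≡∑⁴E₁₃ = ∑⁴-relabel₃₄ (λ a b c d → cong (_* δ a d) (sym (⟦edges⟧-swap₃₄ a b c d)))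
      ∑⁴E₂₃≡∑⁴E₁₃ : ∑⁴ E₂₃ ≡ ∑⁴ E₁₃
      ∑⁴E₂₃≡∑⁴E₁₃ = ∑⁴-relabel₁₂ (λ a b c d → cong (_* δ b c) (sym (⟦edges⟧-swap₁₂ a b c d)))
      ∑⁴E₂₄≡∑⁴E₁₃ : ∑⁴ E₂₄ ≡ ∑⁴ E₁₃
      ∑⁴E₂₄≡∑⁴E₁₃ = trans (∑⁴-relabel₁₂ (λ a b c d → cong (_* δ b d) (sym (⟦edges⟧-swap₁₂ a b c d))))
                          ∑⁴E₁₄≡∑⁴E₁₃
      four-Q : ∑⁴ (λ a b c d → E₁₃ a b c d + (E₁₄ a b c d + (E₂₃ a b c d + E₂₄ a b c d))) ≡ Q + (Q + (Q + Q))
      four-Q = begin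
        ∑⁴ (λ a b c d → E₁₃ a b c d + (E₁₄ a b c d + (E₂₃ a b c d + E₂₄ a b c d)))
          ≡⟨ ∑⁴-distrib-+ E₁₃ _ ⟩
        ∑⁴ E₁₃ + ∑⁴ (λ a b c d → E₁₄ a b c d + (E₂₃ a b c d + E₂₄ a b c d))
          ≡⟨ cong (∑⁴ E₁₃ +_) (trans (∑⁴-distrib-+ E₁₄ _) (cong (∑⁴ E₁₄ +_) (∑⁴-distrib-+ E₂₃ E₂₄))) ⟩
        ∑⁴ E₁₃ + (∑⁴ E₁₄ + (∑⁴ E₂₃ + ∑⁴ E₂₄))
          ≡⟨ cong₂ _+_ ∑⁴E₁₃ (cong₂ _+_ (trans ∑⁴E₁₄≡∑⁴E₁₃ ∑⁴E₁₃)
                                        (cong₂ _+_ (trans ∑⁴E₂₃≡∑⁴E₁₃ ∑⁴E₁₃) (trans ∑⁴E₂₄≡∑⁴E₁₃ ∑⁴E₁₃))) ⟩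
        Q + (Q + (Q + Q))
          ∎

  disjoint-swap₁₂ : ∀ {a b c d} → Disjoint a b c d → Disjoint b a c d
  disjoint-swap₁₂ (ab , cd , a≢c , a≢d , b≢c , b≢d) = Adj-sym ab , cd , b≢c , b≢d , a≢c , a≢d

  disjoint-swap₃₄ : ∀ {a b c d} → Disjoint a b c d → Disjoint a b d c
  disjoint-swap₃₄ (ab , cd , a≢c , a≢d , b≢c , b≢d) = ab , Adj-sym cd , a≢d , a≢c , b≢d , b≢c

  disjoint-swap-edges : ∀ {a b c d} → Disjoint a b c d → Disjoint c d a b
  disjoint-swap-edges (ab , cd , a≢c , a≢d , b≢c , b≢d) = cd , ab , ≢-sym a≢c , ≢-sym b≢c , ≢-sym a≢d , ≢-sym b≢d

  ⟦disjoint⟧-swap₁₂ : ∀ a b c d → ⟦disjoint⟧ b a c d ≡ ⟦disjoint⟧ a b c d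
  ⟦disjoint⟧-swap₁₂ a b c d = ⟦⟧-cong (mk⇔ disjoint-swap₁₂ disjoint-swap₁₂) (disjoint? b a c d) (disjoint? a b c d)

  ⟦disjoint⟧-swap₃₄ : ∀ a b c d → ⟦disjoint⟧ a b d c ≡ ⟦disjoint⟧ a b c d
  ⟦disjoint⟧-swap₃₄ a b c d = ⟦⟧-cong (mk⇔ disjoint-swap₃₄ disjoint-swap₃₄) (disjoint? a b d c) (disjoint? a b c d)

  ⟦disjoint⟧-swap-edges : ∀ a b c d → ⟦disjoint⟧ c d a b ≡ ⟦disjoint⟧ a b c d
  ⟦disjoint⟧-swap-edges a b c d = ⟦⟧-cong (mk⇔ disjoint-swap-edges disjoint-swap-edges) (disjoint? c d a b) (disjoint? a b c d)

  ⟦disjoint⟧-loop₁₂ : ∀ a c d → ⟦disjoint⟧ a a c d ≡ 0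
  ⟦disjoint⟧-loop₁₂ a c d = ⟦⟧-no (λ (aa , _) → Adj-irrefl aa) (disjoint? a a c d)

  ⟦disjoint⟧-loop₃₄ : ∀ a b c → ⟦disjoint⟧ a b c c ≡ 0
  ⟦disjoint⟧-loop₃₄ a b c = ⟦⟧-no (λ (_ , cc , _) → Adj-irrefl cc) (disjoint? a b c c)

  ⟦disjoint⟧-meet₁₃ : ∀ a b d → ⟦disjoint⟧ a b a d ≡ 0
  ⟦disjoint⟧-meet₁₃ a b d = ⟦⟧-no (λ (_ , _ , a≢a , _) → a≢a refl) (disjoint? a b a d)

  L : ℕ
  L = ∑⁴ λ a b c d → ⟦disjoint⟧ a b c d * ⟦ a <? b ⟧ * ⟦ c <? d ⟧ * ⟦ a <? c ⟧

  -- Each unordered pair of disjoint edges occurs 2 · 2 · 2 times in ∑⁴ ⟦disjoint⟧: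
  -- orient either edge, and order the two edges.
  ∑⁴⟦disjoint⟧ : ∑⁴ ⟦disjoint⟧ ≡ 2 * (2 * (2 * L))
  ∑⁴⟦disjoint⟧ = begin
    ∑⁴ ⟦disjoint⟧
      ≡⟨ ∑²-halve (λ a b → ∑ λ c → ∑ (⟦disjoint⟧ a b c))
                  (λ a b → ∑-cong λ c → ∑-cong λ d → ⟦disjoint⟧-swap₁₂ a b c d)
                  (λ a → trans (∑-cong λ c → ∑-cong λ d → ⟦disjoint⟧-loop₁₂ a c d) (∑²-zero)) ⟩
    2 * (∑ λ a → ∑ λ b → (∑ λ c → ∑ (⟦disjoint⟧ a b c)) * ⟦ a <? b ⟧)
      ≡⟨ cong (2 *_) (∑-cong λ a → ∑-cong λ b → trans (sym (∑²-*ʳ ⟦ a <? b ⟧ (⟦disjoint⟧ a b))) (inner a b)) ⟩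
    2 * (∑ λ a → ∑ λ b → 2 * ∑ λ c → ∑ λ d → ⟦disjoint⟧₂ a b c d)
      ≡⟨ cong (2 *_) (∑²-*ˡ 2 (λ a b → ∑ λ c → ∑ (⟦disjoint⟧₂ a b c))) ⟩
    2 * (2 * ∑⁴ ⟦disjoint⟧₂)
      ≡⟨ cong (λ x → 2 * (2 * x)) (trans (∑⁴-swap₂₃ ⟦disjoint⟧₂) outer) ⟩
    2 * (2 * (2 * L))
      ∎
    where
      ⟦disjoint⟧₂ : Fin n → Fin n → Fin n → Fin n → ℕ
      ⟦disjoint⟧₂ a b c d = ⟦disjoint⟧ a b c d * ⟦ a <? b ⟧ * ⟦ c <? d ⟧
      ∑²-zero : ∑ {n} (λ _ → ∑ {n} (λ _ → 0)) ≡ 0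
      ∑²-zero = trans (∑-cong {n} (λ _ → ∑-zero n)) (∑-zero n)
      inner : ∀ a b → ∑ (λ c → ∑ (λ d → ⟦disjoint⟧ a b c d * ⟦ a <? b ⟧)) ≡ 2 * ∑ (λ c → ∑ (⟦disjoint⟧₂ a b c))
      inner a b = ∑²-halve (λ c d → ⟦disjoint⟧ a b c d * ⟦ a <? b ⟧)
                           (λ c d → cong (_* ⟦ a <? b ⟧) (⟦disjoint⟧-swap₃₄ a b c d))
                           (λ c → cong (_* ⟦ a <? b ⟧) (⟦disjoint⟧-loop₃₄ a b c))
      ⟦disjoint⟧₂-swap-edges : ∀ a b c d → ⟦disjoint⟧₂ c d a b ≡ ⟦disjoint⟧₂ a b c d
      ⟦disjoint⟧₂-swap-edges a b c d = begin
        ⟦disjoint⟧ c d a b * ⟦ c <? d ⟧ * ⟦ a <? b ⟧   ≡⟨ *-assoc (⟦disjoint⟧ c d a b) _ _ ⟩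
        ⟦disjoint⟧ c d a b * (⟦ c <? d ⟧ * ⟦ a <? b ⟧) ≡⟨ cong₂ _*_ (⟦disjoint⟧-swap-edges a b c d) (*-comm ⟦ c <? d ⟧ _) ⟩
        ⟦disjoint⟧ a b c d * (⟦ a <? b ⟧ * ⟦ c <? d ⟧) ≡⟨ sym (*-assoc (⟦disjoint⟧ a b c d) _ _) ⟩
        ⟦disjoint⟧₂ a b c d                            ∎
      outer : (∑ λ a → ∑ λ c → ∑ λ b → ∑ λ d → ⟦disjoint⟧₂ a b c d) ≡ 2 * L
      outer = begin
        (∑ λ a → ∑ λ c → ∑ λ b → ∑ λ d → ⟦disjoint⟧₂ a b c d)
          ≡⟨ ∑²-halve (λ a c → ∑ λ b → ∑ λ d → ⟦disjoint⟧₂ a b c d)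
                      (λ a c → trans (∑-cong λ b → ∑-cong λ d → ⟦disjoint⟧₂-swap-edges a d c b)
                                     (∑-comm (λ b d → ⟦disjoint⟧₂ a d c b)))
                      (λ a → trans (∑-cong λ b → ∑-cong λ d → cong (λ x → x * ⟦ a <? b ⟧ * ⟦ a <? d ⟧) (⟦disjoint⟧-meet₁₃ a b d))
                                   ∑²-zero) ⟩
        2 * (∑ λ a → ∑ λ c → (∑ λ b → ∑ λ d → ⟦disjoint⟧₂ a b c d) * ⟦ a <? c ⟧)
          ≡⟨ cong (2 *_) (∑-cong λ a → ∑-cong λ c → sym (∑²-*ʳ ⟦ a <? c ⟧ (λ b d → ⟦disjoint⟧₂ a b c d))) ⟩
        2 * (∑ λ a → ∑ λ c → ∑ λ b → ∑ λ d → ⟦disjoint⟧₂ a b c d * ⟦ a <? c ⟧)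
          ≡⟨ cong (2 *_) (sym (∑⁴-swap₂₃ (λ a b c d → ⟦disjoint⟧₂ a b c d * ⟦ a <? c ⟧))) ⟩
        2 * L
          ∎

  ⟦disjointEdgePair⟧ : ∀ a b c d →
    ⟦ disjointEdgePair? G (a , b , c , d) ⟧ ≡ ⟦disjoint⟧ a b c d * ⟦ a <? b ⟧ * ⟦ c <? d ⟧ * ⟦ a <? c ⟧
  ⟦disjointEdgePair⟧ a b c d = begin
    ⟦ disjointEdgePair? G (a , b , c , d) ⟧
      ≡⟨ ⟦⟧-cong (mk⇔ to from) (disjointEdgePair? G (a , b , c , d)) (((disjoint? a b c d ×-dec a <? b) ×-dec c <? d) ×-dec a <? c) ⟩
    ⟦ ((disjoint? a b c d ×-dec a <? b) ×-dec c <? d) ×-dec a <? c ⟧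
      ≡⟨ trans (⟦×-dec⟧ ((disjoint? a b c d ×-dec a <? b) ×-dec c <? d) (a <? c))
           (cong (_* ⟦ a <? c ⟧) (trans (⟦×-dec⟧ (disjoint? a b c d ×-dec a <? b) (c <? d))
             (cong (_* ⟦ c <? d ⟧) (⟦×-dec⟧ (disjoint? a b c d) (a <? b))))) ⟩
    ⟦disjoint⟧ a b c d * ⟦ a <? b ⟧ * ⟦ c <? d ⟧ * ⟦ a <? c ⟧
      ∎
    where
      to : DisjointEdgePair G (a , b , c , d) → ((Disjoint a b c d × a < b) × c < d) × a < c
      to (a<b , c<d , a<c , b≢c , b≢d , ab , cd) =
        (((ab , cd , <⇒≢ a<c , <⇒≢ (<-trans a<c c<d) , b≢c , b≢d) , a<b) , c<d) , a<c
      from : ((Disjoint a b c d × a < b) × c < d) × a < c → DisjointEdgePair G (a , b , c , d)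
      from ((((ab , cd , _ , _ , b≢c , b≢d) , a<b) , c<d) , a<c) = a<b , c<d , a<c , b≢c , b≢d , ab , cd

  disjointEdgePairs-count : 8 * length (disjointEdgePairs G) + 4 * Q ≡ S * S + 2 * S
  disjointEdgePairs-count = begin
    8 * length (disjointEdgePairs G) + 4 * Q
      ≡⟨ cong (λ x → 8 * x + 4 * Q) (trans (length-filter-tuples (disjointEdgePair? G)) (∑⁴-cong ⟦disjointEdgePair⟧)) ⟩
    8 * L + 4 * Q                            ≡⟨ rearrange L Q ⟩
    2 * (2 * (2 * L)) + (Q + (Q + (Q + Q)))  ≡⟨ cong (_+ (Q + (Q + (Q + Q)))) (sym ∑⁴⟦disjoint⟧) ⟩
    ∑⁴ ⟦disjoint⟧ + (Q + (Q + (Q + Q)))      ≡⟨ sym degree-identity ⟩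
    S * S + (S + S)                          ≡⟨ cong (S * S +_) (cong (S +_) (sym (+-identityʳ S))) ⟩
    S * S + 2 * S                            ∎
    where
      rearrange : ∀ x y → 8 * x + 4 * y ≡ 2 * (2 * (2 * x)) + (y + (y + (y + y)))
      rearrange = solve-∀

disjointEdgePairs-degree-invariant : ∀ {n} {G G′ : Graph n} → SimpleGraph G → SimpleGraph G′ → (∀ v → deg G v ≡ deg G′ v) →
  length (disjointEdgePairs G) ≡ length (disjointEdgePairs G′)
disjointEdgePairs-degree-invariant {G = G} {G′} simple simple′ deg≡ =
  *-cancelˡ-≡ _ _ 8 (+-cancelʳ-≡ (4 * Q′) _ _ (begin
    8 * length (disjointEdgePairs G) + 4 * Q′   ≡⟨ cong (λ q → 8 * length (disjointEdgePairs G) + 4 * q) (sym Q≡Q′) ⟩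
    8 * length (disjointEdgePairs G) + 4 * Q    ≡⟨ Count.disjointEdgePairs-count ⟩
    S * S + 2 * S                               ≡⟨ cong (λ s → s * s + 2 * s) S≡S′ ⟩
    S′ * S′ + 2 * S′                            ≡⟨ sym Count′.disjointEdgePairs-count ⟩
    8 * length (disjointEdgePairs G′) + 4 * Q′  ∎))
  where
    module Count  = DisjointEdgePairCount G simple
    module Count′ = DisjointEdgePairCount G′ simple′
    open Count using (S; Q)
    open Count′ using () renaming (S to S′; Q to Q′)
    S≡S′ : S ≡ S′
    S≡S′ = ∑-cong deg≡
    Q≡Q′ : Q ≡ Q′
    Q≡Q′ = ∑-cong (λ v → cong₂ _*_ (deg≡ v) (deg≡ v))

-- Forests, walks and cycles

module _ {A : Set} where

  Without : Rel A 0ℓ → A → A → Rel A 0ℓ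
  Without R x y u v = R u v × ¬ SameEdge u v x y

  -- R, read as an undirected graph, is a forest
  NoBypass : Rel A 0ℓ → Set
  NoBypass R = ∀ {x y} → R x y → ¬ Star (Without R x y) x y

  NoBypass-⊆ : ∀ {R S : Rel A 0ℓ} → (∀ {u v} → R u v → S u v) → NoBypass S → NoBypass R
  NoBypass-⊆ R⊆S noBypass xy W = noBypass (R⊆S xy) (Star.map (Product.map₁ R⊆S) W)

  -- cut a walk in R ∪ E at its first and at its last E-step
  first-last : ∀ {R E : Rel A 0ℓ} {x y} → Star (λ u v → R u v ⊎ E u v) x y →
    Star R x y ⊎ Σ A λ z → Σ A λ z′ → Star R x z × (∃ λ w → E z w) × (∃ λ w → E w z′) × Star R z′ y
  first-last ε = inj₁ ε
  first-last (inj₁ r ◅ W) with first-last W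
  ... | inj₁ W′                           = inj₁ (r ◅ W′)
  ... | inj₂ (z , z′ , W₁ , e₁ , e₂ , W₂) = inj₂ (z , z′ , r ◅ W₁ , e₁ , e₂ , W₂)
  first-last {x = x} (_◅_ {j = w} (inj₂ e) W) with first-last W
  ... | inj₁ W′                         = inj₂ (x , w , ε , (w , e) , (x , e) , W′)
  ... | inj₂ (_ , z′ , _ , _ , e₂ , W₂) = inj₂ (x , z′ , ε , (w , e) , e₂ , W₂)

  NoBypass-∪-edge : ∀ {R : Rel A 0ℓ} {p q} → Symmetric R → NoBypass R → ¬ Star R p q →
                    NoBypass (λ u v → R u v ⊎ SameEdge u v p q)
  NoBypass-∪-edge {R} {p} {q} R-sym noBypass ¬pq = noBypass′
    where
      ¬connected : ∀ {x y} → SameEdge x y p q → ¬ Star R x y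
      ¬connected (inj₁ (refl , refl)) W = ¬pq W
      ¬connected (inj₂ (refl , refl)) W = ¬pq (Star.reverse R-sym W)

      noBypass′ : NoBypass (λ u v → R u v ⊎ SameEdge u v p q)
      noBypass′ {x} {y} (inj₂ xy≈pq) W = ¬connected xy≈pq (Star.map onlyR W)
        where
          onlyR : ∀ {u v} → Without (λ u v → R u v ⊎ SameEdge u v p q) x y u v → R u v
          onlyR (inj₁ r , _)      = r
          onlyR (inj₂ uv≈pq , ¬xy) = ⊥-elim (¬xy (SameEdge-trans uv≈pq (SameEdge-sym xy≈pq)))
      noBypass′ {x} {y} (inj₁ xy) W with first-last (Star.map split W)
        where
          split : ∀ {u v} → Without (λ u v → R u v ⊎ SameEdge u v p q) x y u v → Without R x y u v ⊎ SameEdge u v p q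
          split (inj₁ r , ¬xy) = inj₁ (r , ¬xy)
          split (inj₂ e , _)   = inj₂ e
      ... | inj₁ W′ = noBypass xy W′
      ... | inj₂ (z , z′ , W₁ , (_ , e₁) , (_ , e₂) , W₂) = join (endpoint e₁) (endpoint (SameEdge-swapˡ e₂))
        where
          endpoint : ∀ {u v} → SameEdge u v p q → u ≡ p ⊎ u ≡ q
          endpoint (inj₁ (u≡p , _)) = inj₁ u≡p
          endpoint (inj₂ (u≡q , _)) = inj₂ u≡q
          around : Star R z z′
          around = Star.reverse R-sym (Star.map proj₁ W₁) ◅◅ xy ◅ Star.reverse R-sym (Star.map proj₁ W₂)
          join : z ≡ p ⊎ z ≡ q → z′ ≡ p ⊎ z′ ≡ q → ⊥
          join (inj₁ refl) (inj₁ refl) = noBypass xy (W₁ ◅◅ W₂)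
          join (inj₂ refl) (inj₂ refl) = noBypass xy (W₁ ◅◅ W₂)
          join (inj₁ refl) (inj₂ refl) = ¬connected SameEdge-refl around
          join (inj₂ refl) (inj₁ refl) = ¬connected SameEdge-flip around

Walk⇒Star : ∀ {n} {G : Graph n} {u v} → Walk G u v → Star (Adj G) u v
Walk⇒Star here       = ε
Walk⇒Star (step e W) = e ◅ Walk⇒Star W

Bypass : ∀ {n} → Graph n → Fin n → Fin n → Set
Bypass G x y = Star (Without (Adj G) x y) x y

module _ {n : ℕ} where

  open import Data.List.Membership.DecPropositional {A = Fin n} _≟_ using (_∈?_)

  data Last : List (Fin n) → Fin n → Set where
    [_]  : ∀ v → Last (v ∷ []) v
    _∷_ : ∀ {w L v} u → Last (w ∷ L) v → Last (u ∷ w ∷ L) v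

  record Path (R : Rel (Fin n) 0ℓ) (x y : Fin n) : Set where
    constructor path
    field
      vertices : List (Fin n)
      unique   : Unique (x ∷ vertices)
      linked   : Linked R (x ∷ vertices)
      last     : Last (x ∷ vertices) y

  private
    ∉⇒All≢ : ∀ {x} (L : List (Fin n)) → x ∉ L → All (x ≢_) L
    ∉⇒All≢ []      _   = []
    ∉⇒All≢ (y ∷ L) x∉L = (x∉L ∘ here) ∷ ∉⇒All≢ L (x∉L ∘ there)

    suffix : ∀ {R x w y} (L : List (Fin n)) → x ∈ w ∷ L → Unique (w ∷ L) → Linked R (w ∷ L) → Last (w ∷ L) y → Path R x y
    suffix L       (here refl) unique linked last = path L unique linked last
    suffix []      (there ())  _ _ _
    suffix (u ∷ L) (there x∈L) (_ ∷ unique) (_ ∷ linked) (_ ∷ last) = suffix L x∈L unique linked last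

  erase : ∀ {R x y} → Star R x y → Path R x y
  erase {x = x} ε = path [] ([] ∷ []) [-] [ x ]
  erase {x = x} (_◅_ {j = w} r rs) with erase rs
  ... | path L unique linked last with x ∈? w ∷ L
  ...   | yes x∈ = suffix L x∈ unique linked last
  ...   | no  x∉ = path (w ∷ L) (∉⇒All≢ (w ∷ L) x∉ ∷ unique) (r ∷ linked) (x ∷ last)

  Last⇒∷ʳ : ∀ {w L y} → Last (w ∷ L) y → Σ (List (Fin n)) λ ys → w ∷ L ≡ ys ∷ʳ y
  Last⇒∷ʳ [ v ] = [] , refl
  Last⇒∷ʳ (u ∷ last) with Last⇒∷ʳ last
  ... | ys , eq = u ∷ ys , cong (u ∷_) eq

  Last-∷ʳ : ∀ u (ys : List (Fin n)) y → Last ((u ∷ ys) ∷ʳ y) y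
  Last-∷ʳ u []       y = u ∷ [ y ]
  Last-∷ʳ u (z ∷ zs) y = u ∷ Last-∷ʳ z zs y

  Linked⇒Star : ∀ {R : Rel (Fin n) 0ℓ} {u y} {L : List (Fin n)} → Linked R (u ∷ L) → Last (u ∷ L) y → Star R u y
  Linked⇒Star {L = []}    [-]      [ _ ]      = ε
  Linked⇒Star {L = _ ∷ _} (r ∷ rs) (_ ∷ last) = r ◅ Linked⇒Star rs last

  Linked-All : ∀ {R : Rel (Fin n) 0ℓ} {P : Fin n → Set} {L} → Linked R L → All P L →
               Linked (λ u v → R u v × P u × P v) L
  Linked-All []       []             = []
  Linked-All [-]      (p ∷ [])       = [-]
  Linked-All (r ∷ rs) (p ∷ (q ∷ ps)) = (r , p , q) ∷ Linked-All rs (q ∷ ps)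

  bypass⇒cycle : ∀ {G : Graph n} {x y} → x ≢ y → Adj G y x → Bypass G x y → HasCycle G
  bypass⇒cycle {G} {x} {y} x≢y yx W with erase W
  ... | path []          _      _                 [ _ ]       = ⊥-elim (x≢y refl)
  ... | path (_ ∷ [])     _      ((_ , ¬xy) ∷ [-]) (_ ∷ [ _ ]) = ⊥-elim (¬xy SameEdge-refl)
  ... | path (_ ∷ _ ∷ _) unique linked            (_ ∷ last) with Last⇒∷ʳ last
  ...   | [] , ()
  ...   | z ∷ zs , eq =
          x , z ∷ zs , y , s≤s z≤n ,
          subst (λ M → Unique (x ∷ M)) eq unique ,
          subst (λ M → Linked (Adj G) (x ∷ M)) eq (Linked.map proj₁ linked) , yx

  cycle⇒bypass : ∀ {G : Graph n} → HasCycle G → Σ (Fin n) λ x → Σ (Fin n) λ y → Adj G y x × Bypass G x y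
  cycle⇒bypass (x , [] , y , () , _)
  cycle⇒bypass {G} (x , h ∷ zs , y , _ , (x≢ ∷ (h≢ ∷ _)) , (xh ∷ linked) , yx) =
    x , y , yx , (xh , ¬xy) ◅ Star.map avoid (Linked⇒Star (Linked-All linked x≢) (Last-∷ʳ h zs y))
    where
      ¬xy : ¬ SameEdge x h x y
      ¬xy (inj₁ (_ , h≡y)) = proj₂ (∷ʳ⁻ {xs = zs} h≢) h≡y
      ¬xy (inj₂ (x≡y , _)) = proj₂ (∷ʳ⁻ {xs = h ∷ zs} x≢) x≡y
      avoid : ∀ {u v} → Adj G u v × x ≢ u × x ≢ v → Without (Adj G) x y u v
      avoid (uv , x≢u , x≢v) = uv , λ { (inj₁ (u≡x , _)) → x≢u (sym u≡x) ; (inj₂ (_ , v≡x)) → x≢v (sym v≡x) }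

module SimpleGraphCycles {n : ℕ} (G : Graph n) (simple : SimpleGraph G) where

  open SimpleGraphProperties G simple

  acyclic⇒NoBypass : ¬ HasCycle G → NoBypass (Adj G)
  acyclic⇒NoBypass acyclic xy W = acyclic (bypass⇒cycle {G = G} (Adj⇒≢ xy) (Adj-sym xy) W)

  NoBypass⇒acyclic : NoBypass (Adj G) → ¬ HasCycle G
  NoBypass⇒acyclic noBypass cycle with cycle⇒bypass {G = G} cycle
  ... | _ , _ , yx , W = noBypass (Adj-sym yx) W

-- 2-switches

ifRemovedAdded≡true⇔ : ∀ {R A : Set} (r? : Dec R) (a? : Dec A) (g : Bool) →
  ((if does r? then false else if does a? then true else g) ≡ true) ⇔ (¬ R × (A ⊎ g ≡ true))
ifRemovedAdded≡true⇔ (yes r) a?      g = mk⇔ (λ ()) (λ (¬r , _) → ⊥-elim (¬r r))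
ifRemovedAdded≡true⇔ (no ¬r) (yes a) g = mk⇔ (λ _ → ¬r , inj₁ a) (λ _ → refl)
ifRemovedAdded≡true⇔ (no ¬r) (no ¬a) g = mk⇔ (λ g≡ → ¬r , inj₂ g≡) λ { (_ , inj₁ a) → ⊥-elim (¬a a) ; (_ , inj₂ g≡) → g≡ }

module _ {n : ℕ} where

  Removed Added : Fin n → Fin n → Fin n → Fin n → Fin n → Fin n → Set
  Removed a b c d u v = SameEdge u v a b ⊎ SameEdge u v c d
  Added   a b c d u v = SameEdge u v a c ⊎ SameEdge u v b d

  removed? : ∀ a b c d u v → Dec (Removed a b c d u v)
  removed? a b c d u v = sameEdge? u v a b ⊎-dec sameEdge? u v c d

  added? : ∀ a b c d u v → Dec (Added a b c d u v)
  added?   a b c d u v = sameEdge? u v a c ⊎-dec sameEdge? u v b d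

  switch-entry : ∀ (G : Graph n) a b c d u v → lookup (lookup (switch G a b c d) u) v ≡
    (if does (removed? a b c d u v) then false else if does (added? a b c d u v) then true else lookup (lookup G u) v)
  switch-entry G a b c d u v =
    trans (cong (λ row → lookup row v) (lookup∘tabulate (λ u → tabulate (λ v → switchEntry u v)) u))
          (lookup∘tabulate (switchEntry u) v)
    where
      switchEntry : Fin n → Fin n → Bool
      switchEntry u v = if does (removed? a b c d u v) then false else if does (added? a b c d u v) then true else lookup (lookup G u) v

  Adj-switch : ∀ {G : Graph n} {a b c d u v} → Adj (switch G a b c d) u v ⇔ (¬ Removed a b c d u v × (Added a b c d u v ⊎ Adj G u v))
  Adj-switch {G} {a} {b} {c} {d} {u} {v} =
    subst (λ t → (t ≡ true) ⇔ (¬ Removed a b c d u v × (Added a b c d u v ⊎ Adj G u v))) (sym (switch-entry G a b c d u v))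
          (ifRemovedAdded≡true⇔ (removed? a b c d u v) (added? a b c d u v) (lookup (lookup G u) v))

  switch-cong : ∀ (G : Graph n) {a b c d a′ b′ c′ d′} →
    (∀ {u v} → Removed a b c d u v ⇔ Removed a′ b′ c′ d′ u v) → (∀ {u v} → Added a b c d u v ⇔ Added a′ b′ c′ d′ u v) →
    switch G a b c d ≡ switch G a′ b′ c′ d′
  switch-cong G {a} {b} {c} {d} {a′} {b′} {c′} {d′} R⇔ A⇔ =
    tabulate-cong λ u → tabulate-cong λ v →
      cong₂ (λ r s → if r then false else if s then true else lookup (lookup G u) v)
            (does-⇔ R⇔ (removed? a b c d u v) (removed? a′ b′ c′ d′ u v))
            (does-⇔ A⇔ (added? a b c d u v) (added? a′ b′ c′ d′ u v))

  switch-flip : ∀ (G : Graph n) a b c d → switch G a b c d ≡ switch G b a d c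
  switch-flip G a b c d = switch-cong G (mk⇔ flip flip) (mk⇔ Sum.swap Sum.swap)
    where
      flip : ∀ {u v x y z w} → (SameEdge u v x y ⊎ SameEdge u v z w) → (SameEdge u v y x ⊎ SameEdge u v w z)
      flip = Sum.map SameEdge-swapʳ SameEdge-swapʳ

  switch-swap : ∀ (G : Graph n) a b c d → switch G a b c d ≡ switch G c d a b
  switch-swap G a b c d = switch-cong G (mk⇔ Sum.swap Sum.swap) (mk⇔ flip flip)
    where
      flip : ∀ {u v x y z w} → (SameEdge u v x y ⊎ SameEdge u v z w) → (SameEdge u v y x ⊎ SameEdge u v w z)
      flip = Sum.map SameEdge-swapʳ SameEdge-swapʳ

  SameEdgePair : Fin n → Fin n → Fin n → Fin n → Fin n → Fin n → Fin n → Fin n → Set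
  SameEdgePair a′ b′ c′ d′ a b c d =
    (SameEdge a′ b′ a b × SameEdge c′ d′ c d) ⊎ (SameEdge a′ b′ c d × SameEdge c′ d′ a b)

  -- On a fixed pair of edges {a′b′, c′d′} there are two 2-switches, adding a′c′, b′d′ resp. a′d′, b′c′.
  switch-SameEdgePair : ∀ (G : Graph n) {a b c d a′ b′ c′ d′} → SameEdgePair a′ b′ c′ d′ a b c d →
    switch G a b c d ≡ switch G a′ b′ c′ d′ ⊎ (switch G a b c d ≡ switch G a′ b′ d′ c′ × Added a b c d b′ c′)
  switch-SameEdgePair G {a} {b} {c} {d} (inj₁ (inj₁ (refl , refl) , inj₁ (refl , refl))) = inj₁ refl
  switch-SameEdgePair G {a} {b} {c} {d} (inj₁ (inj₂ (refl , refl) , inj₁ (refl , refl))) =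
    inj₂ (switch-flip G a b c d , inj₁ SameEdge-refl)
  switch-SameEdgePair G {a} {b} {c} {d} (inj₁ (inj₁ (refl , refl) , inj₂ (refl , refl))) =
    inj₂ (refl , inj₂ SameEdge-refl)
  switch-SameEdgePair G {a} {b} {c} {d} (inj₁ (inj₂ (refl , refl) , inj₂ (refl , refl))) =
    inj₁ (switch-flip G a b c d)
  switch-SameEdgePair G {a} {b} {c} {d} (inj₂ (inj₁ (refl , refl) , inj₁ (refl , refl))) =
    inj₁ (switch-swap G a b c d)
  switch-SameEdgePair G {a} {b} {c} {d} (inj₂ (inj₂ (refl , refl) , inj₁ (refl , refl))) =
    inj₂ (trans (switch-swap G a b c d) (switch-flip G c d a b) , inj₁ SameEdge-flip)
  switch-SameEdgePair G {a} {b} {c} {d} (inj₂ (inj₁ (refl , refl) , inj₂ (refl , refl))) =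
    inj₂ (switch-swap G a b c d , inj₂ SameEdge-flip)
  switch-SameEdgePair G {a} {b} {c} {d} (inj₂ (inj₂ (refl , refl) , inj₂ (refl , refl))) =
    inj₁ (trans (switch-swap G a b c d) (switch-flip G c d a b))

module SwitchedGraph {n : ℕ} (G : Graph n) (a b c d : Fin n) where

  H : Graph n
  H = switch G a b c d

  Adj-switch⁻ : ∀ {u v} → Adj H u v → ¬ Removed a b c d u v × (Added a b c d u v ⊎ Adj G u v)
  Adj-switch⁻ = Equivalence.to (Adj-switch {G = G})

  Adj-switch⁺ : ∀ {u v} → ¬ Removed a b c d u v → Added a b c d u v ⊎ Adj G u v → Adj H u v
  Adj-switch⁺ ¬r a⊎g = Equivalence.from (Adj-switch {G = G}) (¬r , a⊎g)

  Removed⇒¬Adj : ∀ {u v} → Removed a b c d u v → ¬ Adj H u v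
  Removed⇒¬Adj r uv = proj₁ (Adj-switch⁻ uv) r

  ¬Adj⇒Removed : ∀ {u v} → Adj G u v → ¬ Adj H u v → Removed a b c d u v
  ¬Adj⇒Removed {u} {v} uv ¬uv with removed? a b c d u v
  ... | yes r  = r
  ... | no ¬r = ⊥-elim (¬uv (Adj-switch⁺ ¬r (inj₂ uv)))

  switch-simple : SimpleGraph G → a ≢ c → b ≢ d → SimpleGraph H
  switch-simple (symmetric , loopless) a≢c b≢d = symmetricH , looplessH
    where
      flip : ∀ {u v x y z w} → (SameEdge u v x y ⊎ SameEdge u v z w) → (SameEdge v u x y ⊎ SameEdge v u z w)
      flip = Sum.map SameEdge-swapˡ SameEdge-swapˡ
      symmetricH : ∀ u v → lookup (lookup H u) v ≡ lookup (lookup H v) u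
      symmetricH u v = begin
        lookup (lookup H u) v
          ≡⟨ switch-entry G a b c d u v ⟩
        (if does (removed? a b c d u v) then false else if does (added? a b c d u v) then true else lookup (lookup G u) v)
          ≡⟨ cong₂ (λ r s → if r then false else if s then true else lookup (lookup G u) v)
                   (does-⇔ (mk⇔ flip flip) (removed? a b c d u v) (removed? a b c d v u))
                   (does-⇔ (mk⇔ flip flip) (added? a b c d u v) (added? a b c d v u)) ⟩
        (if does (removed? a b c d v u) then false else if does (added? a b c d v u) then true else lookup (lookup G u) v)
          ≡⟨ cong (if does (removed? a b c d v u) then false else_) (cong (if does (added? a b c d v u) then true else_) (symmetric u v)) ⟩
        (if does (removed? a b c d v u) then false else if does (added? a b c d v u) then true else lookup (lookup G v) u)
          ≡⟨ sym (switch-entry G a b c d v u) ⟩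
        lookup (lookup H v) u
          ∎
      ¬loop : ∀ {u} → ¬ Adj H u u
      ¬loop uu with Adj-switch⁻ uu
      ... | _ , inj₁ (inj₁ (inj₁ (refl , refl))) = a≢c refl
      ... | _ , inj₁ (inj₁ (inj₂ (refl , refl))) = a≢c refl
      ... | _ , inj₁ (inj₂ (inj₁ (refl , refl))) = b≢d refl
      ... | _ , inj₁ (inj₂ (inj₂ (refl , refl))) = b≢d refl
      ... | _ , inj₂ uu′ = SimpleGraphProperties.Adj-irrefl G (symmetric , loopless) uu′
      looplessH : ∀ u → lookup (lookup H u) u ≡ false
      looplessH u = Bool.¬-not ¬loop

Distinct : ∀ {n} → Fin n → Fin n → Fin n → Fin n → Set
Distinct a b c d = a ≢ b × a ≢ c × a ≢ d × b ≢ c × b ≢ d × c ≢ d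

module TreeSwitch {n : ℕ} (T : Graph n) (simple : SimpleGraph T) (acyclic : ¬ HasCycle T) where

  open SimpleGraphProperties T simple
  open SimpleGraphCycles T simple

  Kept : Fin n → Fin n → Fin n → Fin n → Rel (Fin n) 0ℓ
  Kept a b c d u v = Adj T u v × ¬ Removed a b c d u v

  Kept-sym : ∀ {a b c d} → Symmetric (Kept a b c d)
  Kept-sym (uv , ¬r) = Adj-sym uv , ¬r ∘ Sum.map SameEdge-swapˡ SameEdge-swapˡ

  Kept-NoBypass : ∀ {a b c d} → NoBypass (Kept a b c d)
  Kept-NoBypass = NoBypass-⊆ proj₁ (acyclic⇒NoBypass acyclic)

  -- The 2-switch of T on ab, cd is a forest when some path of T − {ab, cd} runs from b to c.
  module Bridged {a b c d} (distinct : Distinct a b c d) (ab : Adj T a b) (cd : Adj T c d) (bridge : Star (Kept a b c d) b c) where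

    private
      K = Kept a b c d
      a≢b = proj₁ distinct
      a≢c = proj₁ (proj₂ distinct)
      a≢d = proj₁ (proj₂ (proj₂ distinct))
      b≢c = proj₁ (proj₂ (proj₂ (proj₂ distinct)))
      b≢d = proj₁ (proj₂ (proj₂ (proj₂ (proj₂ distinct))))

    noBypass : NoBypass (Adj T)
    noBypass = acyclic⇒NoBypass acyclic

    avoid-ab : ∀ {u v} → K u v → Without (Adj T) a b u v
    avoid-ab (uv , ¬r) = uv , ¬r ∘ inj₁

    avoid-cd : ∀ {u v} → K u v → Without (Adj T) c d u v
    avoid-cd (uv , ¬r) = uv , ¬r ∘ inj₂

    bridge⁻¹ : Star K c b
    bridge⁻¹ = Star.reverse Kept-sym bridge

    ¬K-ab : ¬ Star K a b
    ¬K-ab W = noBypass ab (Star.map avoid-ab W)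

    ¬K-ac : ¬ Star K a c
    ¬K-ac W = ¬K-ab (W ◅◅ bridge⁻¹)

    ¬K-ad : ¬ Star K a d
    ¬K-ad W = noBypass ab (Star.map avoid-ab W ◅◅ (Adj-sym cd , dc≉ab) ◅ Star.map avoid-ab bridge⁻¹)
      where
        dc≉ab : ¬ SameEdge d c a b
        dc≉ab (inj₁ (d≡a , _)) = a≢d (sym d≡a)
        dc≉ab (inj₂ (d≡b , _)) = b≢d (sym d≡b)

    ¬K-bd : ¬ Star K b d
    ¬K-bd W = noBypass cd (Star.map avoid-cd (bridge⁻¹ ◅◅ W))

    ¬K-cd : ¬ Star K c d
    ¬K-cd W = noBypass cd (Star.map avoid-cd W)

    ¬Adj-ac : ¬ Adj T a c
    ¬Adj-ac ac = noBypass ab ((ac , ac≉ab) ◅ Star.map avoid-ab bridge⁻¹)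
      where
        ac≉ab : ¬ SameEdge a c a b
        ac≉ab (inj₁ (_ , c≡b))  = b≢c (sym c≡b)
        ac≉ab (inj₂ (a≡b , _)) = a≢b a≡b

    ¬Adj-bd : ¬ Adj T b d
    ¬Adj-bd bd = noBypass cd (Star.map avoid-cd bridge⁻¹ ◅◅ (bd , bd≉cd) ◅ ε)
      where
        bd≉cd : ¬ SameEdge b d c d
        bd≉cd (inj₁ (b≡c , _)) = b≢c b≡c
        bd≉cd (inj₂ (b≡d , _)) = b≢d b≡d

    private
      K+ac : Rel (Fin n) 0ℓ
      K+ac u v = K u v ⊎ SameEdge u v a c

      K+ac-sym : Symmetric K+ac
      K+ac-sym = Sum.map Kept-sym SameEdge-swapˡ

      ¬K+ac-bd : ¬ Star K+ac b d
      ¬K+ac-bd W with first-last W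
      ... | inj₁ W′ = ¬K-bd W′
      ... | inj₂ (_ , _ , _ , _ , (_ , inj₁ (_ , refl)) , W₂) = ¬K-cd W₂
      ... | inj₂ (_ , _ , _ , _ , (_ , inj₂ (_ , refl)) , W₂) = ¬K-ad W₂

    open SwitchedGraph T a b c d using (H; Adj-switch⁻; Adj-switch⁺; switch-simple)

    H-simple : SimpleGraph H
    H-simple = switch-simple simple a≢c b≢d

    -- ac joins the components of a and of {b, c} in T − {ab, cd}; bd then joins the component of d.
    H-acyclic : ¬ HasCycle H
    H-acyclic = SimpleGraphCycles.NoBypass⇒acyclic H H-simple (NoBypass-⊆ H⊆ K+ac+bd-NoBypass)
      where
        K+ac-NoBypass : NoBypass K+ac
        K+ac-NoBypass = NoBypass-∪-edge Kept-sym Kept-NoBypass ¬K-ac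
        K+ac+bd-NoBypass : NoBypass (λ u v → K+ac u v ⊎ SameEdge u v b d)
        K+ac+bd-NoBypass = NoBypass-∪-edge K+ac-sym K+ac-NoBypass ¬K+ac-bd
        H⊆ : ∀ {u v} → Adj H u v → K+ac u v ⊎ SameEdge u v b d
        H⊆ uv with Adj-switch⁻ uv
        ... | _  , inj₁ (inj₁ ac) = inj₁ (inj₂ ac)
        ... | _  , inj₁ (inj₂ bd) = inj₂ bd
        ... | ¬r , inj₂ uv′       = inj₁ (inj₁ (uv′ , ¬r))

    forest-neighbour : FNeighbour T H
    forest-neighbour = (H-simple , H-acyclic) , a , b , c , d , distinct , ab , cd , ¬Adj-ac , ¬Adj-bd , refl

    -- the other 2-switch on ab, cd adds bc, which closes a cycle with the bridge
    other-not-forest : ¬ Adj T b c → ¬ IsForest (switch T a b d c)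
    other-not-forest ¬bc (_ , acyclic′) =
      acyclic′ (bypass⇒cycle {G = H′} (≢-sym b≢c) (Adj-switch⁺′ bc≉removed (inj₁ (inj₂ SameEdge-refl))) (Star.map kept′ bridge⁻¹))
      where
        open SwitchedGraph T a b d c using () renaming (H to H′; Adj-switch⁺ to Adj-switch⁺′)
        bc≉removed : ¬ Removed a b d c b c
        bc≉removed (inj₁ (inj₁ (b≡a , _))) = a≢b (sym b≡a)
        bc≉removed (inj₁ (inj₂ (_ , c≡a))) = a≢c (sym c≡a)
        bc≉removed (inj₂ (inj₁ (b≡d , _))) = b≢d b≡d
        bc≉removed (inj₂ (inj₂ (b≡c , _))) = b≢c b≡c
        kept′ : ∀ {u v} → K u v → Without (Adj H′) c b u v
        kept′ (uv , ¬r) = Adj-switch⁺′ (¬r ∘ Sum.map₂ SameEdge-swapʳ) (inj₂ uv) ,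
                          λ uv≈cb → ¬bc (Adj-SameEdge uv (SameEdge-sym (SameEdge-swapʳ uv≈cb)))

-- Forest neighbours of a tree

Unique-map⁺-on : ∀ {A B : Set} (f : A → B) {L : List A} →
  (∀ {x y} → x ∈ L → y ∈ L → f x ≡ f y → x ≡ y) → Unique L → Unique (map f L)
Unique-map⁺-on f {[]}     _   []           = []
Unique-map⁺-on f {x ∷ xs} inj (x∉xs ∷ uxs) = ≢-map xs (λ y∈ → y∈) x∉xs ∷ Unique-map⁺-on f (λ p q → inj (there p) (there q)) uxs
  where
    ≢-map : ∀ ys → (∀ {y} → y ∈ ys → y ∈ xs) → All (x ≢_) ys → All (f x ≢_) (map f ys)
    ≢-map []       _   []           = []
    ≢-map (y ∷ ys) sub (x≢y ∷ x≢ys) = (x≢y ∘ inj (here refl) (there (sub (here refl)))) ∷ ≢-map ys (sub ∘ there) x≢ys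

HasSize-map : ∀ {A B : Set} {P : A → Set} {Q : B → Set} {k} (f : A → B) →
  (∀ {x y} → P x → P y → f x ≡ f y → x ≡ y) → (∀ {x} → P x → Q (f x)) → (∀ {y} → Q y → Σ A λ x → P x × y ≡ f x) →
  HasSize P k → HasSize Q k
HasSize-map {Q = Q} f f-injective P⇒Q Q⇒P (L , L-unique , ∈L⇔P , L-length) =
  map f L ,
  Unique-map⁺-on f (λ x∈ y∈ → f-injective (to x∈) (to y∈)) L-unique ,
  (λ y → mk⇔ (λ y∈ → let (x , x∈ , y≡) = ∈-map⁻ f y∈ in subst Q (sym y≡) (P⇒Q (to x∈)))
              (λ Qy → let (x , Px , y≡) = Q⇒P Qy in subst (_∈ map f L) (sym y≡) (∈-map⁺ f (from Px)))) ,
  trans (length-map f L) L-length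
  where
    to   = λ {x} → Equivalence.to (∈L⇔P x)
    from = λ {x} → Equivalence.from (∈L⇔P x)

module _ {n : ℕ} where

  Distinct-SameEdge : ∀ {a b c d a′ b′ c′ d′ : Fin n} → Distinct a b c d →
    SameEdge a′ b′ a b → SameEdge c′ d′ c d → Distinct a′ b′ c′ d′
  Distinct-SameEdge D (inj₁ (refl , refl)) (inj₁ (refl , refl)) = D
  Distinct-SameEdge (a≢b , a≢c , a≢d , b≢c , b≢d , c≢d) (inj₂ (refl , refl)) (inj₁ (refl , refl)) =
    ≢-sym a≢b , b≢c , b≢d , a≢c , a≢d , c≢d
  Distinct-SameEdge (a≢b , a≢c , a≢d , b≢c , b≢d , c≢d) (inj₁ (refl , refl)) (inj₂ (refl , refl)) =
    a≢b , a≢d , a≢c , b≢d , b≢c , ≢-sym c≢d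
  Distinct-SameEdge (a≢b , a≢c , a≢d , b≢c , b≢d , c≢d) (inj₂ (refl , refl)) (inj₂ (refl , refl)) =
    ≢-sym a≢b , b≢d , b≢c , a≢d , a≢c , ≢-sym c≢d

  Distinct-swap : ∀ {a b c d : Fin n} → Distinct a b c d → Distinct c d a b
  Distinct-swap (a≢b , a≢c , a≢d , b≢c , b≢d , c≢d) = c≢d , ≢-sym a≢c , ≢-sym b≢c , ≢-sym a≢d , ≢-sym b≢d , a≢b

  Distinct-SameEdgePair : ∀ {a b c d a′ b′ c′ d′ : Fin n} → Distinct a b c d →
    SameEdgePair a′ b′ c′ d′ a b c d → Distinct a′ b′ c′ d′
  Distinct-SameEdgePair D (inj₁ (p , q)) = Distinct-SameEdge D p q
  Distinct-SameEdgePair D (inj₂ (p , q)) = Distinct-SameEdge (Distinct-swap D) p q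

  SameEdgePair-trans : ∀ {a b c d a₀ b₀ c₀ d₀ a′ b′ c′ d′ : Fin n} → SameEdgePair a₀ b₀ c₀ d₀ a b c d →
    SameEdge a′ b′ a₀ b₀ → SameEdge c′ d′ c₀ d₀ → SameEdgePair a′ b′ c′ d′ a b c d
  SameEdgePair-trans (inj₁ (p , q)) p′ q′ = inj₁ (SameEdge-trans p′ p , SameEdge-trans q′ q)
  SameEdgePair-trans (inj₂ (p , q)) p′ q′ = inj₂ (SameEdge-trans p′ p , SameEdge-trans q′ q)

  DisjointEdgePair⇒Distinct : ∀ (G : Graph n) {a b c d} → DisjointEdgePair G (a , b , c , d) → Distinct a b c d
  DisjointEdgePair⇒Distinct _ (a<b , c<d , a<c , b≢c , b≢d , _) = <⇒≢ a<b , <⇒≢ a<c , <⇒≢ (<-trans a<c c<d) , b≢c , b≢d , <⇒≢ c<d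

  SameEdge-ordered : ∀ {x y z w : Fin n} → x < y → z < w → SameEdge x y z w → x ≡ z × y ≡ w
  SameEdge-ordered _   _   (inj₁ e)             = e
  SameEdge-ordered x<y z<w (inj₂ (refl , refl)) = ⊥-elim (<-asym x<y z<w)

  -- the canonical tuple of a pair of disjoint edges is determined by the edges
  DisjointEdgePair-unique : ∀ (G : Graph n) {a b c d a′ b′ c′ d′} →
    DisjointEdgePair G (a , b , c , d) → DisjointEdgePair G (a′ , b′ , c′ , d′) →
    Removed a′ b′ c′ d′ a b → Removed a′ b′ c′ d′ c d → Removed a b c d a′ b′ → (a , b , c , d) ≡ (a′ , b′ , c′ , d′)
  DisjointEdgePair-unique _ (a<b , c<d , a<c , _) (a′<b′ , c′<d′ , a′<c′ , _) ab′ cd′ a′b′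
    with ab′ | cd′ | a′b′
  ... | inj₁ e₁ | inj₂ e₂ | _
      with refl , refl ← SameEdge-ordered a<b a′<b′ e₁ | refl , refl ← SameEdge-ordered c<d c′<d′ e₂ = refl
  ... | inj₁ e₁ | inj₁ e₂ | _
      with refl , refl ← SameEdge-ordered a<b a′<b′ e₁ | refl , refl ← SameEdge-ordered c<d a′<b′ e₂ = ⊥-elim (<-irrefl refl a<c)
  ... | inj₂ e₁ | _ | inj₁ e₃
      with refl , refl ← SameEdge-ordered a<b c′<d′ e₁ | refl , refl ← SameEdge-ordered a′<b′ a<b e₃ = ⊥-elim (<-irrefl refl a′<c′)
  ... | inj₂ e₁ | _ | inj₂ e₃
      with refl , refl ← SameEdge-ordered a<b c′<d′ e₁ | refl , refl ← SameEdge-ordered a′<b′ c<d e₃ = ⊥-elim (<-asym a<c a′<c′)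

  ordered : ∀ {x y : Fin n} → x ≢ y → Σ (Fin n) λ x′ → Σ (Fin n) λ y′ → x′ < y′ × SameEdge x′ y′ x y
  ordered {x} {y} x≢y with <-cmp x y
  ... | tri< x<y _ _ = x , y , x<y , SameEdge-refl
  ... | tri≈ _ x≡y _ = ⊥-elim (x≢y x≡y)
  ... | tri> _ _ y<x = y , x , y<x , SameEdge-flip

  Removed-SameEdge : ∀ {a b c d a′ b′ c′ d′ u v : Fin n} → SameEdge a′ b′ a b → SameEdge c′ d′ c d →
    Removed a′ b′ c′ d′ u v → Removed a b c d u v
  Removed-SameEdge p q = Sum.map (λ e → SameEdge-trans e p) (λ e → SameEdge-trans e q)

module TreeForestNeighbours {n : ℕ} (T : Graph n) (simple : SimpleGraph T) (connected : Connected T) (acyclic : ¬ HasCycle T) where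

  open SimpleGraphProperties T simple
  open TreeSwitch T simple acyclic

  canonical : ∀ {a b c d} → Distinct a b c d → Adj T a b → Adj T c d →
    Σ (Tuple n) λ { (a₀ , b₀ , c₀ , d₀) → DisjointEdgePair T (a₀ , b₀ , c₀ , d₀) × SameEdgePair a₀ b₀ c₀ d₀ a b c d }
  canonical D ab cd with ordered (proj₁ D) | ordered (proj₂ (proj₂ (proj₂ (proj₂ (proj₂ D)))))
  ... | a₀ , b₀ , a₀<b₀ , p | c₀ , d₀ , c₀<d₀ , q with Distinct-SameEdge D p q | <-cmp a₀ c₀
  ...   | _ , _ , a₀≢d₀ , b₀≢c₀ , b₀≢d₀ , _ | tri< a₀<c₀ _ _ =
          (a₀ , b₀ , c₀ , d₀) ,
          (a₀<b₀ , c₀<d₀ , a₀<c₀ , b₀≢c₀ , b₀≢d₀ , Adj-SameEdge ab p , Adj-SameEdge cd q) , inj₁ (p , q)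
  ...   | _ , a₀≢c₀ , _ | tri≈ _ a₀≡c₀ _ = ⊥-elim (a₀≢c₀ a₀≡c₀)
  ...   | _ , _ , a₀≢d₀ , b₀≢c₀ , b₀≢d₀ , _ | tri> _ _ c₀<a₀ =
          (c₀ , d₀ , a₀ , b₀) ,
          (c₀<d₀ , a₀<b₀ , c₀<a₀ , ≢-sym a₀≢d₀ , ≢-sym b₀≢d₀ , Adj-SameEdge cd q , Adj-SameEdge ab p) , inj₂ (q , p)

  EndOf : Fin n → Fin n → Fin n → Set
  EndOf x y v = v ≡ x ⊎ v ≡ y

  -- Follow a walk of T until it first reaches {c, d}, restarting after every use of ab.
  reach : ∀ {a b c d w t} → Star (Adj T) w t → EndOf c d t →
    (Σ (Fin n) λ y → EndOf c d y × Star (Kept a b c d) w y) ⊎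
    (Σ (Fin n) λ x → Σ (Fin n) λ y → EndOf a b x × EndOf c d y × Star (Kept a b c d) x y)
  reach {w = w} ε t∈cd = inj₁ (w , t∈cd , ε)
  reach {a} {b} {c} {d} {w} (_◅_ {j = u} wu W) t∈cd with sameEdge? w u c d
  ... | yes (inj₁ (w≡c , _)) = inj₁ (w , inj₁ w≡c , ε)
  ... | yes (inj₂ (w≡d , _)) = inj₁ (w , inj₂ w≡d , ε)
  ... | no ≉cd with sameEdge? w u a b | reach W t∈cd
  ...   | _                    | inj₂ r               = inj₂ r
  ...   | yes (inj₁ (_ , u≡b)) | inj₁ (y , y∈cd , W′) = inj₂ (u , y , inj₂ u≡b , y∈cd , W′)
  ...   | yes (inj₂ (_ , u≡a)) | inj₁ (y , y∈cd , W′) = inj₂ (u , y , inj₁ u≡a , y∈cd , W′)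
  ...   | no ≉ab               | inj₁ (y , y∈cd , W′) = inj₁ (y , y∈cd , (wu , [ ≉ab , ≉cd ]′) ◅ W′)

  record Orientation (a b c d : Fin n) : Set where
    constructor orientation
    field
      a′ b′ c′ d′ : Fin n
      first  : SameEdge a′ b′ a b
      second : SameEdge c′ d′ c d
      bridge : Star (Kept a′ b′ c′ d′) b′ c′

  Kept-SameEdge : ∀ {a b c d a′ b′ c′ d′ u v} → SameEdge a′ b′ a b → SameEdge c′ d′ c d →
    Kept a b c d u v → Kept a′ b′ c′ d′ u v
  Kept-SameEdge p q (uv , ¬r) = uv , ¬r ∘ Removed-SameEdge p q

  orientation-from : ∀ {a b c d x y} → EndOf a b x → EndOf c d y → Star (Kept a b c d) x y → Orientation a b c d
  orientation-from {a} {b} {c} {d} (inj₁ refl) (inj₁ refl) W =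
    orientation b a c d SameEdge-flip SameEdge-refl (Star.map (Kept-SameEdge SameEdge-flip SameEdge-refl) W)
  orientation-from {a} {b} {c} {d} (inj₁ refl) (inj₂ refl) W =
    orientation b a d c SameEdge-flip SameEdge-flip (Star.map (Kept-SameEdge SameEdge-flip SameEdge-flip) W)
  orientation-from {a} {b} {c} {d} (inj₂ refl) (inj₁ refl) W =
    orientation a b c d SameEdge-refl SameEdge-refl W
  orientation-from {a} {b} {c} {d} (inj₂ refl) (inj₂ refl) W =
    orientation a b d c SameEdge-refl SameEdge-flip (Star.map (Kept-SameEdge SameEdge-refl SameEdge-flip) W)

  orient : ∀ a b c d → Orientation a b c d
  orient a b c d with reach {a} {b} {c} {d} (Walk⇒Star (connected b c)) (inj₁ refl)
  ... | inj₁ (_ , y∈cd , W)            = orientation-from (inj₂ refl) y∈cd W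
  ... | inj₂ (_ , _ , x∈ab , y∈cd , W) = orientation-from x∈ab y∈cd W

  forestSwitch : ∀ {a b c d} → Orientation a b c d → Graph n
  forestSwitch (orientation a′ b′ c′ d′ _ _ _) = switch T a′ b′ c′ d′

  forestSwitch-FNeighbour : ∀ {a b c d} → Distinct a b c d → Adj T a b → Adj T c d →
    (o : Orientation a b c d) → FNeighbour T (forestSwitch o)
  forestSwitch-FNeighbour D ab cd (orientation _ _ _ _ p q W) =
    Bridged.forest-neighbour (Distinct-SameEdge D p q) (Adj-SameEdge ab p) (Adj-SameEdge cd q) W

  forestSwitch-removes : ∀ {a b c d u v} (o : Orientation a b c d) → Removed a b c d u v → ¬ Adj (forestSwitch o) u v
  forestSwitch-removes (orientation a′ b′ c′ d′ p q _) r =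
    SwitchedGraph.Removed⇒¬Adj T a′ b′ c′ d′ (Removed-SameEdge (SameEdge-sym p) (SameEdge-sym q) r)

  forestSwitch-keeps : ∀ {a b c d u v} (o : Orientation a b c d) → Adj T u v → ¬ Adj (forestSwitch o) u v → Removed a b c d u v
  forestSwitch-keeps (orientation a′ b′ c′ d′ p q _) uv ¬uv =
    Removed-SameEdge p q (SwitchedGraph.¬Adj⇒Removed T a′ b′ c′ d′ uv ¬uv)

  forestSwitch-unique : ∀ {a b c d a₀ b₀ c₀ d₀} → Distinct a b c d → Adj T a b → Adj T c d → ¬ Adj T a c → ¬ Adj T b d →
    IsForest (switch T a b c d) → SameEdgePair a₀ b₀ c₀ d₀ a b c d → (o : Orientation a₀ b₀ c₀ d₀) → switch T a b c d ≡ forestSwitch o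
  forestSwitch-unique {a} {b} {c} {d} D ab cd ¬ac ¬bd forest same (orientation a′ b′ c′ d′ p q W)
    with switch-SameEdgePair T (SameEdgePair-trans same p q)
  ... | inj₁ eq = eq
  ... | inj₂ (eq , added) =
        ⊥-elim (Bridged.other-not-forest (Distinct-SameEdgePair D same′) a′b′ c′d′ W ¬b′c′ (subst IsForest eq forest))
    where
      same′ = SameEdgePair-trans same p q
      edges : Adj T a′ b′ × Adj T c′ d′
      edges with same′
      ... | inj₁ (p′ , q′) = Adj-SameEdge ab p′ , Adj-SameEdge cd q′
      ... | inj₂ (p′ , q′) = Adj-SameEdge cd p′ , Adj-SameEdge ab q′
      a′b′ = proj₁ edges
      c′d′ = proj₂ edges
      ¬b′c′ : ¬ Adj T b′ c′
      ¬b′c′ b′c′ = [ (λ e → ¬ac (Adj-SameEdge b′c′ (SameEdge-sym e))) , (λ e → ¬bd (Adj-SameEdge b′c′ (SameEdge-sym e))) ]′ added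

  forestSwitchOf : Tuple n → Graph n
  forestSwitchOf (a , b , c , d) = forestSwitch (orient a b c d)

  forestSwitchOf-injective : ∀ {p p′} → DisjointEdgePair T p → DisjointEdgePair T p′ → forestSwitchOf p ≡ forestSwitchOf p′ → p ≡ p′
  forestSwitchOf-injective {a , b , c , d} {a′ , b′ , c′ , d′} dep@(_ , _ , _ , _ , _ , ab , cd) dep′@(_ , _ , _ , _ , _ , a′b′ , _) eq =
    DisjointEdgePair-unique T dep dep′
      (moved eq ab (inj₁ SameEdge-refl)) (moved eq cd (inj₂ SameEdge-refl)) (moved (sym eq) a′b′ (inj₁ SameEdge-refl))
    where
      moved : ∀ {p p′ u v} → forestSwitchOf p ≡ forestSwitchOf p′ → Adj T u v →
              let (a , b , c , d) = p ; (a′ , b′ , c′ , d′) = p′ in Removed a b c d u v → Removed a′ b′ c′ d′ u v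
      moved {a , b , c , d} {a′ , b′ , c′ , d′} {u} {v} eq uv r =
        forestSwitch-keeps (orient a′ b′ c′ d′) uv (subst (λ H → ¬ Adj H u v) eq (forestSwitch-removes (orient a b c d) r))

  FNeighbour⇒forestSwitchOf : ∀ {H} → FNeighbour T H → Σ (Tuple n) λ p → DisjointEdgePair T p × H ≡ forestSwitchOf p
  FNeighbour⇒forestSwitchOf (forest , a , b , c , d , D , ab , cd , ¬ac , ¬bd , refl) with canonical D ab cd
  ... | (a₀ , b₀ , c₀ , d₀) , dep , same =
        (a₀ , b₀ , c₀ , d₀) , dep , forestSwitch-unique D ab cd ¬ac ¬bd forest same (orient a₀ b₀ c₀ d₀)

  forestNeighbours-size : ∀ {k} → HasSize (DisjointEdgePair T) k → HasSize (FNeighbour T) k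
  forestNeighbours-size = HasSize-map forestSwitchOf forestSwitchOf-injective FNeighbour-forestSwitchOf FNeighbour⇒forestSwitchOf
    where
      FNeighbour-forestSwitchOf : ∀ {p} → DisjointEdgePair T p → FNeighbour T (forestSwitchOf p)
      FNeighbour-forestSwitchOf {a , b , c , d} dep@(_ , _ , _ , _ , _ , ab , cd) =
        forestSwitch-FNeighbour (DisjointEdgePair⇒Distinct T dep) ab cd (orient a b c d)

-- The degree sum of a tree

walkLength : ∀ {A : Set} {R : Rel A 0ℓ} {x y} → Star R x y → ℕ
walkLength ε       = 0
walkLength (_ ◅ W) = suc (walkLength W)

least : (P : ℕ → Set) → (∀ k → Dec (P k)) → ∀ N → P N → Σ ℕ λ k → P k × (∀ j → P j → k ≤ j)
least P P? zero    p = zero , p , λ _ _ → z≤n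
least P P? (suc N) p with P? zero
... | yes p₀ = zero , p₀ , λ _ _ → z≤n
... | no ¬p₀ with least (P ∘ suc) (P? ∘ suc) N p
...   | k , pk , minimal = suc k , pk , minimal′
  where
    minimal′ : ∀ j → P j → suc k ≤ j
    minimal′ zero    pj = ⊥-elim (¬p₀ pj)
    minimal′ (suc j) pj = s≤s (minimal j pj)

-- Root the tree at vertex 0; every other vertex has exactly one neighbour one level closer to the root.
module TreeDegreeSum {m : ℕ} (T : Graph (suc m)) (simple : SimpleGraph T) (connected : Connected T) (acyclic : ¬ HasCycle T) where

  open SimpleGraphProperties T simple
  open SimpleGraphCycles T simple

  private
    V = Fin (suc m)
    root : V
    root = zero

  noBypass : NoBypass (Adj T)
  noBypass = acyclic⇒NoBypass acyclic

  WalkOfLength : V → ℕ → Set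
  WalkOfLength u k = Σ (Star (Adj T) u root) λ W → walkLength W ≡ k

  walkOfLength? : ∀ k u → Dec (WalkOfLength u k)
  walkOfLength? zero u with u ≟ root
  ... | yes refl = yes (ε , refl)
  ... | no u≢r  = no λ { (ε , _) → u≢r refl ; (_ ◅ _ , ()) }
  walkOfLength? (suc k) u with any? (λ w → adj? T u w ×-dec walkOfLength? k w)
  ... | yes (w , uw , W , len) = yes (uw ◅ W , cong suc len)
  ... | no ¬∃ = no λ { (ε , ()) ; (_◅_ {j = w} uw W , len) → ¬∃ (w , uw , W , suc-injective len) }

  shortest : ∀ u → Σ ℕ λ k → WalkOfLength u k × (∀ j → WalkOfLength u j → k ≤ j)
  shortest u = least (WalkOfLength u) (λ k → walkOfLength? k u) _ (Walk⇒Star (connected u root) , refl)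

  level : V → ℕ
  level u = proj₁ (shortest u)

  shortestWalk : ∀ u → Star (Adj T) u root
  shortestWalk u = proj₁ (proj₁ (proj₂ (shortest u)))

  shortestWalk-length : ∀ u → walkLength (shortestWalk u) ≡ level u
  shortestWalk-length u = proj₂ (proj₁ (proj₂ (shortest u)))

  level-minimal : ∀ {u} (W : Star (Adj T) u root) → level u ≤ walkLength W
  level-minimal {u} W = proj₂ (proj₂ (shortest u)) (walkLength W) (W , refl)

  level-root : level root ≡ 0
  level-root = ≤-antisym (level-minimal ε) z≤n

  level-step : ∀ {u v} → Adj T u v → level u ≤ suc (level v)
  level-step {u} {v} uv = subst (λ k → level u ≤ suc k) (shortestWalk-length v) (level-minimal (uv ◅ shortestWalk v))

  avoiding : ∀ z {p} (W : Star (Adj T) p root) → walkLength W ≤ level z → p ≢ z →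
             Star (λ u v → Adj T u v × u ≢ z × v ≢ z) p root
  avoiding z ε                    _   _   = ε
  avoiding z (_◅_ {j = w} pw W) len p≢z = (pw , p≢z , w≢z) ◅ avoiding z W (≤-trans (n≤1+n _) len) w≢z
    where
      w≢z : w ≢ z
      w≢z refl = ℕₚ.<-irrefl refl (≤-<-trans (level-minimal W) len)

  private
    AvoidVertex : V → Rel V 0ℓ
    AvoidVertex z u v = Adj T u v × u ≢ z × v ≢ z

    AvoidVertex-sym : ∀ {z u v} → AvoidVertex z u v → AvoidVertex z v u
    AvoidVertex-sym (uv , u≢z , v≢z) = Adj-sym uv , v≢z , u≢z

    AvoidVertex⇒Withoutˡ : ∀ {x y u v} → AvoidVertex x u v → Without (Adj T) x y u v
    AvoidVertex⇒Withoutˡ (uv , u≢x , v≢x) = uv , λ { (inj₁ (u≡x , _)) → u≢x u≡x ; (inj₂ (_ , v≡x)) → v≢x v≡x }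

    AvoidVertex⇒Withoutʳ : ∀ {x y u v} → AvoidVertex y u v → Without (Adj T) x y u v
    AvoidVertex⇒Withoutʳ (uv , u≢y , v≢y) = uv , λ { (inj₁ (_ , v≡y)) → v≢y v≡y ; (inj₂ (u≡y , _)) → u≢y u≡y }

    shortestWalk-avoiding : ∀ {u z} → level u ≤ level z → u ≢ z → Star (AvoidVertex z) u root
    shortestWalk-avoiding {u} {z} u≤z u≢z =
      avoiding z (shortestWalk u) (subst (_≤ level z) (sym (shortestWalk-length u)) u≤z) u≢z

  level-≢ : ∀ {u v} → Adj T u v → level u ≢ level v
  level-≢ {u} {v} uv u≡v = noBypass uv
    (Star.map AvoidVertex⇒Withoutʳ (shortestWalk-avoiding (subst (level u ≤_) u≡v ≤-refl) (Adj⇒≢ uv)) ◅◅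
     Star.map AvoidVertex⇒Withoutˡ (Star.reverse AvoidVertex-sym
       (shortestWalk-avoiding (subst (_≤ level u) u≡v ≤-refl) (Adj⇒≢ (Adj-sym uv)))))

  IsParent : V → V → Set
  IsParent u p = Adj T u p × suc (level p) ≡ level u

  parent-unique : ∀ {w p p′} → IsParent w p → IsParent w p′ → p ≡ p′
  parent-unique {w} {p} {p′} (wp , p<w) (wp′ , p′<w) with p ≟ p′
  ... | yes p≡p′ = p≡p′
  ... | no p≢p′  = ⊥-elim (noBypass (Adj-sym wp)
    (Star.map AvoidVertex⇒Withoutʳ (shortestWalk-avoiding (below p<w) (≢w p<w)) ◅◅
     Star.map AvoidVertex⇒Withoutʳ (Star.reverse AvoidVertex-sym (shortestWalk-avoiding (below p′<w) (≢w p′<w))) ◅◅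
     (Adj-sym wp′ , p′w≉pw) ◅ ε))
    where
      below : ∀ {q} → suc (level q) ≡ level w → level q ≤ level w
      below q<w = subst (_ ≤_) q<w (n≤1+n _)
      ≢w : ∀ {q} → suc (level q) ≡ level w → q ≢ w
      ≢w q<w refl = 1+n≢n q<w
      p′w≉pw : ¬ SameEdge p′ w p w
      p′w≉pw (inj₁ (p′≡p , _)) = p≢p′ (sym p′≡p)
      p′w≉pw (inj₂ (p′≡w , _)) = ≢w p′<w p′≡w

  parent : ∀ {u} → u ≢ root → ∃ (IsParent u)
  parent {u} u≢r = first-step (shortestWalk u) (shortestWalk-length u)
    where
      first-step : (W : Star (Adj T) u root) → walkLength W ≡ level u → ∃ (IsParent u)
      first-step ε                    _   = ⊥-elim (u≢r refl)
      first-step (_◅_ {j = p} up W) len =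
        p , up , ≤-antisym (subst (suc (level p) ≤_) len (s≤s (level-minimal W))) (level-step up)

  IsParent-root : ∀ {p} → ¬ IsParent root p
  IsParent-root (_ , p<r) with trans p<r level-root
  ... | ()

  edge-orientation : ∀ {u v} → Adj T u v → IsParent u v ⊎ IsParent v u
  edge-orientation {u} {v} uv with ℕₚ.<-cmp (level u) (level v)
  ... | tri≈ _ u≡v _ = ⊥-elim (level-≢ uv u≡v)
  ... | tri< u<v _ _ = inj₂ (Adj-sym uv , ≤-antisym u<v (level-step (Adj-sym uv)))
  ... | tri> _ _ v<u = inj₁ (uv , ≤-antisym v<u (level-step uv))

  parent? : ∀ u p → Dec (IsParent u p)
  parent? u p = adj? T u p ×-dec (suc (level p) ℕ.≟ level u)

  ⟦adj⟧≡⟦parent⟧+⟦parent⟧ : ∀ u v → ⟦ adj? T u v ⟧ ≡ ⟦ parent? u v ⟧ + ⟦ parent? v u ⟧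
  ⟦adj⟧≡⟦parent⟧+⟦parent⟧ u v =
    trans (⟦⟧-cong (mk⇔ edge-orientation [ proj₁ , Adj-sym ∘ proj₁ ]′) (adj? T u v) (parent? u v ⊎-dec parent? v u))
          (⟦⊎-dec⟧ not-both (parent? u v) (parent? v u))
    where
      not-both : ¬ (IsParent u v × IsParent v u)
      not-both ((_ , v<u) , (_ , u<v)) = ℕₚ.<-asym (≤-reflexive v<u) (≤-reflexive u<v)

  ∑⟦parent⟧-root : ∑ (λ p → ⟦ parent? root p ⟧) ≡ 0
  ∑⟦parent⟧-root = trans (∑-cong (λ p → ⟦⟧-no IsParent-root (parent? root p))) (∑-zero (suc m))

  ∑⟦parent⟧ : ∀ {u} → u ≢ root → ∑ (λ p → ⟦ parent? u p ⟧) ≡ 1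
  ∑⟦parent⟧ {u} u≢r with parent u≢r
  ... | p , p-parent = begin
    ∑ (λ q → ⟦ parent? u q ⟧)
      ≡⟨ ∑-cong (λ q → ⟦⟧-cong (mk⇔ (parent-unique p-parent) (λ { refl → p-parent })) (parent? u q) (p ≟ q)) ⟩
    ∑ (λ q → ⟦ p ≟ q ⟧)          ≡⟨ ∑-cong (λ q → sym (*-identityʳ ⟦ p ≟ q ⟧)) ⟩
    ∑ (λ q → ⟦ p ≟ q ⟧ * 1)      ≡⟨ ∑-δ p (λ _ → 1) ⟩
    1                            ∎

  degree-sum : ∑ (deg T) ≡ 2 * m
  degree-sum = begin
    ∑ (deg T)                                              ≡⟨ ∑-cong (deg≡∑⟦adj⟧ T) ⟩
    ∑ (λ u → ∑ (λ v → ⟦ adj? T u v ⟧))                     ≡⟨ ∑-cong (λ u → ∑-cong (⟦adj⟧≡⟦parent⟧+⟦parent⟧ u)) ⟩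
    ∑ (λ u → ∑ (λ v → ⟦ parent? u v ⟧ + ⟦ parent? v u ⟧))  ≡⟨ ∑-cong (λ u → ∑-distrib-+ (λ v → ⟦ parent? u v ⟧) (λ v → ⟦ parent? v u ⟧)) ⟩
    ∑ (λ u → children u + ∑ (λ v → ⟦ parent? v u ⟧))      ≡⟨ ∑-distrib-+ children (λ u → ∑ (λ v → ⟦ parent? v u ⟧)) ⟩
    ∑ children + ∑ (λ u → ∑ (λ v → ⟦ parent? v u ⟧))      ≡⟨ cong (∑ children +_) (sym (∑-comm (λ v u → ⟦ parent? v u ⟧))) ⟩
    ∑ children + ∑ children                                ≡⟨ cong₂ _+_ non-roots non-roots ⟩
    m + m                                                  ≡⟨ cong (m +_) (sym (+-identityʳ m)) ⟩
    2 * m                                                  ∎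
    where
      children : V → ℕ
      children u = ∑ (λ p → ⟦ parent? u p ⟧)
      non-roots : ∑ children ≡ m
      non-roots = trans (cong₂ _+_ ∑⟦parent⟧-root (∑-cong {f = children ∘ suc} (λ i → ∑⟦parent⟧ (λ ())))) (∑-ones m)

2*nC2+n≡n*n : ∀ n → 2 * (n C 2) + n ≡ n * n
2*nC2+n≡n*n zero    = refl
2*nC2+n≡n*n (suc n) = begin
  2 * (suc n C 2) + suc n            ≡⟨ cong (λ x → 2 * x + suc n) (sym (nCk+nC[k+1]≡[n+1]C[k+1] n 1)) ⟩
  2 * (n C 1 + n C 2) + suc n        ≡⟨ cong (λ x → 2 * (x + n C 2) + suc n) (nC1≡n n) ⟩
  2 * (n + n C 2) + suc n            ≡⟨ rearrange n (n C 2) ⟩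
  (2 * (n C 2) + n) + suc (n + n)    ≡⟨ cong (_+ suc (n + n)) (2*nC2+n≡n*n n) ⟩
  n * n + suc (n + n)                ≡⟨ square n ⟩
  suc n * suc n                      ∎
  where
    rearrange : ∀ x y → 2 * (x + y) + suc x ≡ (2 * y + x) + suc (x + x)
    rearrange = solve-∀
    square : ∀ x → x * x + suc (x + x) ≡ suc x * suc x
    square = solve-∀

2*∑[dC2]+∑d≡∑[d*d] : ∀ {n} (d : Fin n → ℕ) → 2 * ∑ (λ v → d v C 2) + ∑ d ≡ ∑ (λ v → d v * d v)
2*∑[dC2]+∑d≡∑[d*d] d = begin
  2 * ∑ (λ v → d v C 2) + ∑ d    ≡⟨ cong (_+ ∑ d) (sym (∑-*ˡ 2 (λ v → d v C 2))) ⟩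
  ∑ (λ v → 2 * (d v C 2)) + ∑ d  ≡⟨ sym (∑-distrib-+ (λ v → 2 * (d v C 2)) d) ⟩
  ∑ (λ v → 2 * (d v C 2) + d v)  ≡⟨ ∑-cong (λ v → 2*nC2+n≡n*n (d v)) ⟩
  ∑ (λ v → d v * d v)            ∎

∑[d^2]≡∑[d*d] : ∀ {n} (d : Fin n → ℕ) → ∑ (λ v → d v ^ 2) ≡ ∑ (λ v → d v * d v)
∑[d^2]≡∑[d*d] d = ∑-cong (λ v → cong (d v *_) (*-identityʳ (d v)))

module TreeCounts {m : ℕ} (T : Graph (suc m)) (simple : SimpleGraph T) (connected : Connected T) (acyclic : ¬ HasCycle T) where

  open DisjointEdgePairCount T simple using (S; Q; disjointEdgePairs-count)
  open TreeDegreeSum T simple connected acyclic using (degree-sum)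

  private
    k R : ℕ
    k = length (disjointEdgePairs T)
    R = ∑ (λ v → deg T v C 2)

  2k+Q≡m*m+m : 2 * k + Q ≡ m * m + m
  2k+Q≡m*m+m = *-cancelˡ-≡ _ _ 4 (begin
    4 * (2 * k + Q)                    ≡⟨ distribute k Q ⟩
    8 * k + 4 * Q                      ≡⟨ disjointEdgePairs-count ⟩
    S * S + 2 * S                      ≡⟨ cong (λ s → s * s + 2 * s) degree-sum ⟩
    2 * m * (2 * m) + 2 * (2 * m)      ≡⟨ expand m ⟩
    4 * (m * m + m)                    ∎)
    where
      distribute : ∀ x y → 4 * (2 * x + y) ≡ 8 * x + 4 * y
      distribute = solve-∀
      expand : ∀ x → 2 * x * (2 * x) + 2 * (2 * x) ≡ 4 * (x * x + x)
      expand = solve-∀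

  2k+∑[d^2]≡2*[1+m]C2 : 2 * k + ∑ (λ v → deg T v ^ 2) ≡ 2 * (suc m C 2)
  2k+∑[d^2]≡2*[1+m]C2 = begin
    2 * k + ∑ (λ v → deg T v ^ 2)  ≡⟨ cong (2 * k +_) (∑[d^2]≡∑[d*d] (deg T)) ⟩
    2 * k + Q                      ≡⟨ 2k+Q≡m*m+m ⟩
    m * m + m                      ≡⟨ cong (_+ m) (sym (2*nC2+n≡n*n m)) ⟩
    2 * (m C 2) + m + m            ≡⟨ rearrange m (m C 2) ⟩
    2 * (m + m C 2)                ≡⟨ cong (λ x → 2 * (x + m C 2)) (sym (nC1≡n m)) ⟩
    2 * (m C 1 + m C 2)            ≡⟨ cong (2 *_) (nCk+nC[k+1]≡[n+1]C[k+1] m 1) ⟩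
    2 * (suc m C 2)                ∎
    where
      rearrange : ∀ x y → 2 * y + x + x ≡ 2 * (x + y)
      rearrange = solve-∀

  k+∑[dC2]≡mC2 : k + R ≡ m C 2
  k+∑[dC2]≡mC2 = *-cancelˡ-≡ _ _ 2 (+-cancelʳ-≡ S _ _ (begin
    2 * (k + R) + S          ≡⟨ rearrange k R S ⟩
    2 * k + (2 * R + S)      ≡⟨ cong (2 * k +_) (2*∑[dC2]+∑d≡∑[d*d] (deg T)) ⟩
    2 * k + Q                ≡⟨ 2k+Q≡m*m+m ⟩
    m * m + m                ≡⟨ cong (_+ m) (sym (2*nC2+n≡n*n m)) ⟩
    2 * (m C 2) + m + m      ≡⟨ +-assoc (2 * (m C 2)) m m ⟩
    2 * (m C 2) + (m + m)    ≡⟨ sym (cong (2 * (m C 2) +_) (trans degree-sum (twice m))) ⟩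
    2 * (m C 2) + S          ∎))
    where
      rearrange : ∀ x y z → 2 * (x + y) + z ≡ 2 * x + (2 * y + z)
      rearrange = solve-∀
      twice : ∀ x → 2 * x ≡ x + x
      twice = solve-∀

tree-counts : ∀ n (T : Graph n) → IsTree T →
  length (disjointEdgePairs T) + ∑ (λ v → deg T v C 2) ≡ (n ∸ 1) C 2 ×
  2 * length (disjointEdgePairs T) + ∑ (λ v → deg T v ^ 2) ≡ 2 * (n C 2)
tree-counts zero    T _                              = refl , refl
tree-counts (suc m) T (simple , connected , acyclic) = k+∑[dC2]≡mC2 , 2k+∑[d^2]≡2*[1+m]C2
  where open TreeCounts T simple connected acyclic

mainTheorem11 : (n : ℕ) (T : Graph n) → IsTree T →
    Σ ℕ λ k →
    HasSize (FNeighbour T) k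
    × (∀ (G : Graph n) → SimpleGraph G → (∀ v → deg G v ≡ deg T v) → HasSize (DisjointEdgePair G) k)
    × k + ∑ (λ v → deg T v C 2) ≡ (n ∸ 1) C 2
    × 2 * k + ∑ (λ v → deg T v ^ 2) ≡ 2 * (n C 2)
mainTheorem11 n T tree@(simple , connected , acyclic) =
  length (disjointEdgePairs T) ,
  TreeForestNeighbours.forestNeighbours-size T simple connected acyclic (disjointEdgePairs-size T) ,
  (λ G simple′ deg≡ → subst (HasSize (DisjointEdgePair G)) (disjointEdgePairs-degree-invariant {G = G} {G′ = T} simple′ simple deg≡)
                            (disjointEdgePairs-size G)) ,
  tree-counts n T tree
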